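{- Let $P=\langle\mu,\lambda\rangle$ be a finite perfect group with $|\mu|=2$, $|\lambda|=3$. Let $X=P\wr\mathrm{A}_5$, $h_1=(1,1,1,\lambda,\lambda^{ -1})(123)$, $h_2=(\mu,\mu,\mu,1,1)(12)(45)$, $g=(1,\mu,1,1,\mu)(14)(25)$, $H=\langle h_1,h_2\rangle$, and $\Gamma=\mathrm{Cos}(X,H,HgH)$. Then: (1) $H=\langle h_1\rangle{:}\langle h_2\rangle\cong \mathrm{S}_3$ and $|g|=2$; (2) $H\cap H^g=\langle h_2\rangle\cong\mathrm{S}_2$; (3) $\Gamma$ is an $(X,2)$-arc-transitive cubic graph; (4) $\Gamma$ is a normal cover of the Petersen graph, namely the normal quotient $\Gamma_N$ for $N=P^5$ is isomorphic to the Petersen graph.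
   Context: $X=P\wr\mathrm{A}_5=P^5{:}\mathrm{A}_5$, where $\mathrm{A}_5=\mathrm{Alt}\{1,\dots,5\}$ (permutations acting on the right) acts on $P^5$ by $(t_1,\dots,t_5)^{\pi^{ -1}}=(t_{1^\pi},\dots,t_{5^\pi})$; elements are written as $(t_1,\dots,t_5)\pi$. $N=P^5$ is the base group. The coset graph $\mathrm{Cos}(X,H,HgH)$ has vertex set the right cosets $Hx$ ($x\in X$), with $Hx\sim Hy$ iff $yx^{ -1}\in HgH$. A graph is $(X,2)$-arc-transitive if $X$ is transitive on $2$-arcs (sequences of $3$ vertices, consecutive adjacent, all three distinct). The normal quotient $\Gamma_N$ has the $N$-orbits on vertices as vertices, adjacent iff some edge joins them. The Petersen graph has vertices the $2$-subsets of $\{1,\dots,5\}$, adjacent iff disjoint. -}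

module Defs where

open import Level using (Level; _⊔_)
open import Data.Bool using (Bool; true; false; if_then_else_)
open import Data.Nat as ℕ using (ℕ; zero; suc; _%_)
open import Data.Fin as F using (Fin; zero; suc; _<?_)
open import Data.Fin.Permutation as Perm
  using (Permutation′; permutation; _⟨$⟩ʳ_; _⟨$⟩ˡ_; _∘ₚ_; flip)
  renaming (_≈_ to _≈ₚ_; id to idₚ)
open import Data.List using (List; []; _∷_; map)
open import Data.Nat.ListAction using (sum)
open import Data.List.Relation.Unary.All using (All)
open import Data.List.Relation.Unary.Any using (Any)
open import Data.Product using (Σ; ∃; ∃₂; _×_; _,_; proj₁; proj₂)
open import Data.Sum using (_⊎_)
open import Data.Vec.Functional using (Vector)
open import Relation.Nullary using (¬_; does)
open import Relation.Unary using (Pred)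
open import Relation.Binary.PropositionalEquality using (_≡_; refl)
open import Algebra.Bundles using (Group)
open import Algebra.Bundles.Raw using (RawGroup)
open import Function.Bundles using (_⇔_)
import Data.List as L

module RG {c ℓ} (G : RawGroup c ℓ) where
  open RawGroup G

  pow : Carrier → ℕ → Carrier
  pow x zero    = ε
  pow x (suc n) = x ∙ pow x n

  -- |x| = n  (n ≥ 1 intended)
  HasOrder : Carrier → ℕ → Set ℓ
  HasOrder x n = (pow x n ≈ ε) × (∀ k → suc k ℕ.< n → ¬ (pow x (suc k) ≈ ε))

  evalW : List (Bool × Carrier) → Carrier
  evalW []                = ε
  evalW ((true  , a) ∷ w) = a ∙ evalW w
  evalW ((false , a) ∷ w) = (a ⁻¹) ∙ evalW w

  Gen : ∀ {ℓ′} → Pred Carrier ℓ′ → Pred Carrier (c ⊔ ℓ ⊔ ℓ′)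
  Gen S x = Σ (List (Bool × Carrier)) λ w → All (λ p → S (proj₂ p)) w × (evalW w ≈ x)

  IsCommutator : Pred Carrier (c ⊔ ℓ)
  IsCommutator y = ∃₂ λ a b → y ≈ (((a ⁻¹) ∙ (b ⁻¹)) ∙ a) ∙ b

  Perfect : Set (c ⊔ ℓ)
  Perfect = ∀ x → Gen IsCommutator x

  Finite : Set (c ⊔ ℓ)
  Finite = (∀ x y → Relation.Nullary.Dec (x ≈ y))
         × Σ (List Carrier) (λ xs → ∀ x → Any (x ≈_) xs)

  IsoTo : ∀ {ℓ′ c₂ ℓ₂} → Pred Carrier ℓ′ → RawGroup c₂ ℓ₂ → Set _
  IsoTo S K = Σ (Carrier → K.Carrier) λ φ →
      (∀ a b → S a → a ≈ b → φ a K.≈ φ b)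
    × (∀ a b → S a → S b → φ (a ∙ b) K.≈ (φ a K.∙ φ b))
    × (∀ a b → S a → S b → φ a K.≈ φ b → a ≈ b)
    × (∀ k → Σ Carrier λ a → S a × (φ a K.≈ k))
    where module K = RawGroup K

-- Symmetric group Sym(n), permutations acting on the right:
-- π ∘ₚ σ is "first π, then σ".

SymRaw : ℕ → RawGroup Level.zero Level.zero
SymRaw n = record
  { Carrier = Permutation′ n ; _≈_ = _≈ₚ_ ; _∙_ = _∘ₚ_ ; ε = idₚ ; _⁻¹ = flip }

inversions : ∀ {n} → Permutation′ n → ℕ
inversions {n} π = sum (map (λ i → sum (map (λ j →
    if does (i <? j) then (if does ((π ⟨$⟩ʳ j) <? (π ⟨$⟩ʳ i)) then 1 else 0) else 0)
    (L.allFin n))) (L.allFin n))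

Even : ∀ {n} → Permutation′ n → Set
Even π = inversions π % 2 ≡ 0

-- The concrete permutations of {1,…,5} = Fin 5 (point k is Fin (k-1))

private
  0F 1F 2F 3F 4F : Fin 5
  0F = zero
  1F = suc zero
  2F = suc (suc zero)
  3F = suc (suc (suc zero))
  4F = suc (suc (suc (suc zero)))

  c123f c123b s12-45 s14-25 : Fin 5 → Fin 5
  c123f zero = 1F
  c123f (suc zero) = 2F
  c123f (suc (suc zero)) = 0F
  c123f i = i
  c123b zero = 2F
  c123b (suc zero) = 0F
  c123b (suc (suc zero)) = 1F
  c123b i = i
  s12-45 zero = 1F
  s12-45 (suc zero) = 0F
  s12-45 (suc (suc zero)) = 2F
  s12-45 (suc (suc (suc zero))) = 4F
  s12-45 (suc (suc (suc (suc zero)))) = 3F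
  s14-25 zero = 3F
  s14-25 (suc zero) = 4F
  s14-25 (suc (suc zero)) = 2F
  s14-25 (suc (suc (suc zero))) = 0F
  s14-25 (suc (suc (suc (suc zero)))) = 1F

  c123-l : ∀ x → c123f (c123b x) ≡ x
  c123-l (zero) = refl
  c123-l (suc zero) = refl
  c123-l (suc (suc zero)) = refl
  c123-l (suc (suc (suc zero))) = refl
  c123-l (suc (suc (suc (suc zero)))) = refl
  c123-r : ∀ x → c123b (c123f x) ≡ x
  c123-r (zero) = refl
  c123-r (suc zero) = refl
  c123-r (suc (suc zero)) = refl
  c123-r (suc (suc (suc zero))) = refl
  c123-r (suc (suc (suc (suc zero)))) = refl
  a-inv : ∀ x → s12-45 (s12-45 x) ≡ x
  a-inv (zero) = refl
  a-inv (suc zero) = refl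
  a-inv (suc (suc zero)) = refl
  a-inv (suc (suc (suc zero))) = refl
  a-inv (suc (suc (suc (suc zero)))) = refl
  b-inv : ∀ x → s14-25 (s14-25 x) ≡ x
  b-inv (zero) = refl
  b-inv (suc zero) = refl
  b-inv (suc (suc zero)) = refl
  b-inv (suc (suc (suc zero))) = refl
  b-inv (suc (suc (suc (suc zero)))) = refl

cyc123 : Permutation′ 5
cyc123 = permutation c123f c123b c123-l c123-r

perm12-45 : Permutation′ 5
perm12-45 = permutation s12-45 s12-45 a-inv a-inv

perm14-25 : Permutation′ 5
perm14-25 = permutation s14-25 s14-25 b-inv b-inv

module Wreath {c ℓ} (P : Group c ℓ) (μ lam : Group.Carrier P) where
  open Group P

  Elem : Set c
  Elem = (Fin 5 → Carrier) × Permutation′ 5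

  -- (t π)(s σ) = (t · s^{π⁻¹}) (πσ),  with (s^{π⁻¹})ᵢ = s_{i^π}
  XRaw : RawGroup c ℓ
  XRaw = record
    { Carrier = Elem
    ; _≈_ = λ x y → (∀ i → proj₁ x i ≈ proj₁ y i) × (proj₂ x ≈ₚ proj₂ y)
    ; _∙_ = λ x y → (λ i → proj₁ x i ∙ proj₁ y (proj₂ x ⟨$⟩ʳ i)) , (proj₂ x ∘ₚ proj₂ y)
    ; ε = (λ _ → ε) , idₚ
    ; _⁻¹ = λ x → (λ j → proj₁ x (proj₂ x ⟨$⟩ˡ j) ⁻¹) , flip (proj₂ x)
    }

  module X = RawGroup XRaw
  open RG XRaw public using () renaming (Gen to XGen; HasOrder to XHasOrder; IsoTo to XIsoTo)

  InX : Elem → Set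
  InX x = Even (proj₂ x)

  InN : Elem → Set
  InN x = proj₂ x ≈ₚ idₚ

  h₁ h₂ g : Elem
  h₁ = (λ { zero → ε ; (suc zero) → ε ; (suc (suc zero)) → ε
          ; (suc (suc (suc zero))) → lam ; (suc (suc (suc (suc zero)))) → lam ⁻¹ }) , cyc123
  h₂ = (λ { zero → μ ; (suc zero) → μ ; (suc (suc zero)) → μ
          ; (suc (suc (suc zero))) → ε ; (suc (suc (suc (suc zero)))) → ε }) , perm12-45
  g  = (λ { zero → ε ; (suc zero) → μ ; (suc (suc zero)) → ε
          ; (suc (suc (suc zero))) → ε ; (suc (suc (suc (suc zero)))) → μ }) , perm14-25

  InH : Elem → Set (c ⊔ ℓ)
  InH = XGen (λ y → (y X.≈ h₁) ⊎ (y X.≈ h₂))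

  In⟨h₁⟩ In⟨h₂⟩ : Elem → Set (c ⊔ ℓ)
  In⟨h₁⟩ = XGen (λ y → y X.≈ h₁)
  In⟨h₂⟩ = XGen (λ y → y X.≈ h₂)

  -- Γ = Cos(X,H,HgH): vertices Hx (x ∈ X), represented by x.
  -- Hx = Hy
  SameV : Elem → Elem → Set (c ⊔ ℓ)
  SameV x y = InH (y X.∙ (x X.⁻¹))

  InHgH : Elem → Set (c ⊔ ℓ)
  InHgH z = ∃₂ λ a b → InH a × InH b × (z X.≈ ((a X.∙ g) X.∙ b))

  Adj : Elem → Elem → Set (c ⊔ ℓ)
  Adj x y = InHgH (y X.∙ (x X.⁻¹))

  IsCubicGraph : Set (c ⊔ ℓ)
  IsCubicGraph =
      (∀ x y → InX x → InX y → Adj x y → Adj y x)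
    × (∀ x → InX x → ¬ Adj x x)
    × (∀ x → InX x → Σ Elem λ y₁ → Σ Elem λ y₂ → Σ Elem λ y₃ →
          (InX y₁ × InX y₂ × InX y₃)
        × (Adj x y₁ × Adj x y₂ × Adj x y₃)
        × (¬ SameV y₁ y₂ × ¬ SameV y₁ y₃ × ¬ SameV y₂ y₃)
        × (∀ y → InX y → Adj x y → SameV y y₁ ⊎ SameV y y₂ ⊎ SameV y y₃))

  Is2Arc : Elem → Elem → Elem → Set (c ⊔ ℓ)
  Is2Arc u v w = (InX u × InX v × InX w) × (Adj u v × Adj v w)
               × (¬ SameV u v × ¬ SameV v w × ¬ SameV u w)

  Is2ArcTransitive : Set (c ⊔ ℓ)
  Is2ArcTransitive = ∀ u v w u′ v′ w′ → Is2Arc u v w → Is2Arc u′ v′ w′ →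
    Σ Elem λ y → InX y × SameV (u X.∙ y) u′ × SameV (v X.∙ y) v′ × SameV (w X.∙ y) w′

  SameOrbit : Elem → Elem → Set (c ⊔ ℓ)
  SameOrbit x y = Σ Elem λ n → InN n × SameV (x X.∙ n) y

  OrbitAdj : Elem → Elem → Set (c ⊔ ℓ)
  OrbitAdj x y = Σ Elem λ x′ → Σ Elem λ y′ →
    InX x′ × InX y′ × SameOrbit x x′ × SameOrbit y y′ × Adj x′ y′

PetV : Set
PetV = Σ (Fin 5 × Fin 5) λ p → proj₁ p F.< proj₂ p

PetEq : PetV → PetV → Set
PetEq p q = proj₁ p ≡ proj₁ q

PetAdj : PetV → PetV → Set
PetAdj ((a , b) , _) ((c , d) , _) = ¬ a ≡ c × ¬ a ≡ d × ¬ b ≡ c × ¬ b ≡ d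

module Quot {c ℓ} (P : Group c ℓ) (μ lam : Group.Carrier P) where
  open Wreath P μ lam
  QuotientIsPetersen : Set (c ⊔ ℓ)
  QuotientIsPetersen = Σ (Elem → PetV) λ φ →
      (∀ x y → InX x → InX y → SameOrbit x y → PetEq (φ x) (φ y))
    × (∀ x y → InX x → InX y → PetEq (φ x) (φ y) → SameOrbit x y)
    × (∀ p → Σ Elem λ x → InX x × PetEq (φ x) p)
    × (∀ x y → InX x → InX y → (OrbitAdj x y → PetAdj (φ x) (φ y))
                              × (PetAdj (φ x) (φ y) → OrbitAdj x y))

module Submission where

open import Defs
open import Data.Nat using (ℕ)
open import Data.Product using (Σ; ∃₂; _×_; _,_)
open import Data.Sum using (_⊎_)
open import Algebra.Bundles using (Group)
open import Function.Bundles using (_⇔_)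

-- Since μ² = λ³ = 1, the coordinates of h₁, h₂, g and of all their products can be written as reduced
-- words in C₂ * C₃ = ⟨μ⟩ * ⟨λ⟩, which maps onto ⟨μ, λ⟩ ≤ P. Identities between such symbolic elements
-- are therefore decided by computation, and H becomes the explicit list ⟨h₁⟩⟨h₂⟩ of six elements;
-- parts (1) and (2) are finite checks on it. The neighbours of Hx are the cosets H g h₁ⁱ x (i < 3), and X
-- moves every 2-arc onto (H, Hg, H g h₁ g), which gives (3). For (4), Hx ↦ {4, 5}^x is constant on
-- N-orbits; two cosets with the same image differ by an even permutation stabilising {4, 5}, all of which
-- come from H, and adjacent cosets have disjoint images, which is Petersen adjacency. That products of
-- elements of X stay in X rests on the parity of the inversion count being multiplicative.

module Permutations where

  open import Data.Nat as ℕ using (ℕ; zero; suc; _≤_)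
  open import Data.Nat.Properties using (≤-refl)
  open import Data.Fin using (Fin; zero; suc; _≟_; toℕ; inject≤; punchIn; punchOut)
  open import Data.Fin.Properties using (all?)
  open import Data.Fin.Permutation
    using (Permutation′; _⟨$⟩ʳ_; _⟨$⟩ˡ_; flip; inverseˡ; inverseʳ; insert; remove; insert-remove)
    renaming (_≈_ to _≈ₚ_; id to idₚ)
  open import Data.List using (List; []; _∷_; map; concatMap; allFin; find)
  open import Data.List.Properties using (map-cong; ≡-dec)
  open import Data.List.Membership.Propositional.Properties using (∈-allFin)
  open import Data.List.Relation.Unary.All using (All; lookupWith)
  open import Data.List.Relation.Unary.Any as Any using (Any; here)
  open import Data.List.Relation.Unary.Any.Properties using (concatMap⁺; map⁺)
  open import Data.Maybe using (fromMaybe)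
  open import Function using (_∘_)
  open import Relation.Binary using (Decidable)
  open import Relation.Binary.PropositionalEquality
  open import Relation.Nullary using (yes; no)
  open import Relation.Unary using (Pred)

  permute-injective : ∀ {n} (π : Permutation′ n) {i j} → π ⟨$⟩ʳ i ≡ π ⟨$⟩ʳ j → i ≡ j
  permute-injective π πi≡πj = trans (sym (inverseˡ π)) (trans (cong (π ⟨$⟩ˡ_) πi≡πj) (inverseˡ π))

  permute-≢ : ∀ {n} (π : Permutation′ n) {i j} → i ≢ j → π ⟨$⟩ʳ i ≢ π ⟨$⟩ʳ j
  permute-≢ π i≢j = i≢j ∘ permute-injective π

  flip-cong : ∀ {n} {π σ : Permutation′ n} → π ≈ₚ σ → flip π ≈ₚ flip σ
  flip-cong {π = π} {σ} π≈σ j =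
    trans (cong (π ⟨$⟩ˡ_) (trans (sym (inverseʳ σ)) (sym (π≈σ (σ ⟨$⟩ˡ j))))) (inverseˡ π)

  infix 4 _≈ₚ?_
  _≈ₚ?_ : ∀ {n} → Decidable (_≈ₚ_ {n} {n})
  π ≈ₚ? σ = all? (λ i → π ⟨$⟩ʳ i ≟ σ ⟨$⟩ʳ i)

  insert-cong : ∀ {m n} (i : Fin (suc m)) (j : Fin (suc n)) {π σ} → π ≈ₚ σ → insert i j π ≈ₚ insert i j σ
  insert-cong i j π≈σ k with i ≟ k
  ... | yes _  = refl
  ... | no i≢k = cong (punchIn j) (π≈σ (punchOut i≢k))

  perms : ∀ n → List (Permutation′ n)
  perms zero    = idₚ ∷ []
  perms (suc n) = concatMap (λ j → map (insert zero j) (perms n)) (allFin (suc n))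

  -- Every permutation is insert 0 (π 0) (remove 0 π).
  perms-complete : ∀ {n} (π : Permutation′ n) → Any (π ≈ₚ_) (perms n)
  perms-complete {zero}  π = here λ ()
  perms-complete {suc n} π = concatMap⁺ (λ j → map (insert zero j) (perms n))
    (Any.map (λ { refl → map⁺ (Any.map π≈insert (perms-complete (remove zero π))) }) (∈-allFin (π ⟨$⟩ʳ zero)))
    where
    π≈insert : ∀ {σ} → remove zero π ≈ₚ σ → π ≈ₚ insert zero (π ⟨$⟩ʳ zero) σ
    π≈insert π′≈σ k = trans (sym (insert-remove zero π k)) (insert-cong zero (π ⟨$⟩ʳ zero) π′≈σ k)

  ∀-perms : ∀ {n p} {P : Pred (Permutation′ n) p} → (∀ {π σ} → π ≈ₚ σ → P σ → P π) →
            All P (perms n) → ∀ π → P π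
  ∀-perms resp all-P π = lookupWith (λ Pσ π≈σ → resp π≈σ Pσ) all-P (perms-complete π)

  images : ∀ {m n} → m ≤ n → Permutation′ n → List ℕ
  images {m} m≤n π = map (λ i → toℕ (π ⟨$⟩ʳ inject≤ i m≤n)) (allFin m)

  withImages : ∀ m → List ℕ → Permutation′ m
  withImages m vs = fromMaybe idₚ (find (λ σ → ≡-dec ℕ._≟_ (images ≤-refl σ) vs) (perms m))

  -- Agrees with π on Fin m when π maps Fin m onto itself; idₚ otherwise.
  restriction : ∀ {m n} → m ≤ n → Permutation′ n → Permutation′ m
  restriction {m} m≤n π = withImages m (images m≤n π)

  restriction-cong : ∀ {m n} (m≤n : m ≤ n) {π σ} → π ≈ₚ σ → restriction m≤n π ≡ restriction m≤n σ
  restriction-cong {m} m≤n π≈σ = cong (withImages m) (map-cong (λ i → cong toℕ (π≈σ (inject≤ i m≤n))) (allFin m))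

module Parity where

  open import Data.Product using (_×_; _,_)
  open import Data.Bool using (Bool; true; false; if_then_else_; not)
  open import Data.Nat using (ℕ; zero; suc; _+_; _*_; _%_)
  open import Data.Nat.Properties using (+-0-commutativeMonoid; +-comm; *-comm; +-identityʳ; *-cancelˡ-≡)
  open import Data.Nat.DivMod using ([m+kn]%n≡m%n; %-distribˡ-+; m%n%n≡m%n)
  open import Data.Nat.ListAction using (sum)
  open import Data.Fin using (Fin; zero; suc; _<?_)
  open import Data.Fin.Properties using (<-cmp; <-irrefl)
  open import Data.Fin.Permutation using (Permutation′; _⟨$⟩ʳ_; _∘ₚ_; flip; inverseˡ)
    renaming (_≈_ to _≈ₚ_; id to idₚ)
  open import Data.List using (allFin; map; tabulate)
  open import Data.List.Properties using (map-tabulate)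
  open import Relation.Nullary using (does; contradiction)
  open import Function using (_∘_; case_of_)
  open import Relation.Nullary.Decidable using (dec-true; dec-false)
  open import Relation.Binary using (tri<; tri≈; tri>)
  open import Relation.Binary.PropositionalEquality
  open import Algebra.Properties.CommutativeMonoid.Sum +-0-commutativeMonoid
    using (sum-cong-≗; sum-replicate-zero; ∑-comm; ∑-distrib-+; sum-permute)
    renaming (sum to ∑)
  open import Defs using (inversions; Even)
  open Permutations using (permute-≢)

  private
    variable
      n : ℕ

  lt : Fin n → Fin n → Bool
  lt a b = does (a <? b)

  when : Bool → ℕ → ℕ
  when b m = if b then m else 0

  indicator : Bool → ℕ
  indicator b = when b 1

  inverts : Permutation′ n → Fin n → Fin n → ℕ
  inverts π i j = when (lt i j) (indicator (lt (π ⟨$⟩ʳ j) (π ⟨$⟩ʳ i)))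

  ΣΣ : (Fin n → Fin n → ℕ) → ℕ
  ΣΣ f = ∑ (λ i → ∑ (f i))

  sum-tabulate : ∀ (f : Fin n → ℕ) → sum (tabulate f) ≡ ∑ f
  sum-tabulate {zero}  f = refl
  sum-tabulate {suc n} f = cong (f zero +_) (sum-tabulate (f ∘ suc))

  sum-allFin : ∀ (f : Fin n → ℕ) → sum (map f (allFin n)) ≡ ∑ f
  sum-allFin f = trans (cong sum (map-tabulate (λ i → i) f)) (sum-tabulate f)

  inversions≡ΣΣ : ∀ (π : Permutation′ n) → inversions π ≡ ΣΣ (inverts π)
  inversions≡ΣΣ {n} π =
    trans (sum-allFin (λ i → sum (map (inverts π i) (allFin n)))) (sum-cong-≗ (λ i → sum-allFin (inverts π i)))

  lt-irrefl : ∀ (a : Fin n) → lt a a ≡ false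
  lt-irrefl a = dec-false (a <? a) (<-irrefl refl)

  lt-flip : ∀ {a b : Fin n} → a ≢ b → lt b a ≡ not (lt a b)
  lt-flip {a = a} {b} a≢b with <-cmp a b
  ... | tri< a<b _ b≮a = trans (dec-false (b <? a) b≮a) (cong not (sym (dec-true (a <? b) a<b)))
  ... | tri≈ _ a≡b _   = contradiction a≡b a≢b
  ... | tri> a≮b _ b<a = trans (dec-true (b <? a) b<a) (cong not (sym (dec-false (a <? b) a≮b)))

  lt⇒≢ : ∀ {a b : Fin n} → lt a b ≡ true → a ≢ b
  lt⇒≢ {a = a} lt≡true refl = case trans (sym lt≡true) (lt-irrefl a) of λ ()

  reverses : Permutation′ n → Fin n → Fin n → ℕ
  reverses π a b = inverts π a b + inverts π b a

  ΣΣ-distrib-+ : ∀ (f g : Fin n → Fin n → ℕ) → ΣΣ (λ i j → f i j + g i j) ≡ ΣΣ f + ΣΣ g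
  ΣΣ-distrib-+ f g = trans (sum-cong-≗ (λ i → ∑-distrib-+ (f i) (g i))) (∑-distrib-+ (λ i → ∑ (f i)) (λ i → ∑ (g i)))

  ΣΣ-symmetrize : ∀ (f : Fin n → Fin n → ℕ) → ΣΣ (λ i j → f i j + f j i) ≡ 2 * ΣΣ f
  ΣΣ-symmetrize f = begin
    ΣΣ (λ i j → f i j + f j i)  ≡⟨ ΣΣ-distrib-+ f (λ i j → f j i) ⟩
    ΣΣ f + ΣΣ (λ i j → f j i)   ≡⟨ cong (ΣΣ f +_) (∑-comm (λ i j → f j i)) ⟩
    ΣΣ f + ΣΣ f                 ≡⟨ cong (ΣΣ f +_) (sym (+-identityʳ _)) ⟩
    2 * ΣΣ f                    ∎
    where open ≡-Reasoning

  ΣΣ-permute : ∀ (f : Fin n → Fin n → ℕ) (π : Permutation′ n) → ΣΣ (λ i j → f (π ⟨$⟩ʳ i) (π ⟨$⟩ʳ j)) ≡ ΣΣ f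
  ΣΣ-permute f π = trans (sum-cong-≗ (λ i → sym (sum-permute (f (π ⟨$⟩ʳ i)) π))) (sym (sum-permute (λ a → ∑ (f a)) π))

  when-true : ∀ {b} m → b ≡ true → when b m ≡ m
  when-true m refl = refl

  when-false : ∀ {b} m → b ≡ false → when b m ≡ 0
  when-false m refl = refl

  reverses-diag : ∀ (π : Permutation′ n) a → reverses π a a ≡ 0
  reverses-diag π a = cong₂ _+_ zero-inv zero-inv
    where
    zero-inv = when-false (indicator (lt (π ⟨$⟩ʳ a) (π ⟨$⟩ʳ a))) (lt-irrefl a)

  -- π permutes the pairs {i, j}, so summing σ's reversals of {π i, π j} over i < j counts each inversion
  -- of σ exactly once.
  reversesAbove : Permutation′ n → Permutation′ n → Fin n → Fin n → ℕ
  reversesAbove π σ i j = when (lt i j) (reverses σ (π ⟨$⟩ʳ i) (π ⟨$⟩ʳ j))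

  reverses-split : ∀ (π σ : Permutation′ n) i j →
    reverses σ (π ⟨$⟩ʳ i) (π ⟨$⟩ʳ j) ≡ reversesAbove π σ i j + reversesAbove π σ j i
  reverses-split π σ i j with <-cmp i j
  ... | tri< i<j _ j≮i = sym (trans (cong₂ _+_ (when-true _ (dec-true (i <? j) i<j)) (when-false _ (dec-false (j <? i) j≮i)))
                                    (+-identityʳ _))
  ... | tri≈ _ refl _  = trans (reverses-diag σ (π ⟨$⟩ʳ i))
                               (sym (cong₂ _+_ (when-false _ (lt-irrefl i)) (when-false _ (lt-irrefl i))))
  ... | tri> i≮j _ j<i = trans (+-comm (inverts σ (π ⟨$⟩ʳ i) (π ⟨$⟩ʳ j)) _)
                               (sym (cong₂ _+_ (when-false _ (dec-false (i <? j) i≮j)) (when-true _ (dec-true (j <? i) j<i))))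

  ΣΣ-reversesAbove : ∀ (π σ : Permutation′ n) → ΣΣ (reversesAbove π σ) ≡ inversions σ
  ΣΣ-reversesAbove π σ = *-cancelˡ-≡ _ _ 2 (begin
    2 * ΣΣ (reversesAbove π σ)                           ≡⟨ sym (ΣΣ-symmetrize (reversesAbove π σ)) ⟩
    ΣΣ (λ i j → reversesAbove π σ i j + reversesAbove π σ j i)
      ≡⟨ sym (sum-cong-≗ (λ i → sum-cong-≗ (reverses-split π σ i))) ⟩
    ΣΣ (λ i j → reverses σ (π ⟨$⟩ʳ i) (π ⟨$⟩ʳ j))      ≡⟨ ΣΣ-permute (reverses σ) π ⟩
    ΣΣ (reverses σ)                                      ≡⟨ ΣΣ-symmetrize (inverts σ) ⟩
    2 * ΣΣ (inverts σ)                                   ≡⟨ cong (2 *_) (sym (inversions≡ΣΣ σ)) ⟩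
    2 * inversions σ                                     ∎)
    where open ≡-Reasoning

  private
    parity-bits : ∀ x p q r s → (x ≡ true → q ≡ not p × s ≡ not r) →
      let a = when x (indicator q)
          t = when x (when p (indicator s) + when q (indicator r))
      in when x (indicator s) + (a * t + a * t) ≡ a + t
    parity-bits false p q r s _ = refl
    parity-bits true  p q r s flips with flips refl
    parity-bits true false _ false _ _ | refl , refl = refl
    parity-bits true false _ true  _ _ | refl , refl = refl
    parity-bits true true  _ false _ _ | refl , refl = refl
    parity-bits true true  _ true  _ _ | refl , refl = refl

  -- π ∘ₚ σ reverses {i, j} iff exactly one of π (on {i, j}) and σ (on {π i, π j}) does.
  inverts-∘ : ∀ (π σ : Permutation′ n) i j →
    let m = inverts π i j * reversesAbove π σ i j in
    inverts (π ∘ₚ σ) i j + (m + m) ≡ inverts π i j + reversesAbove π σ i j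
  inverts-∘ π σ i j = parity-bits (lt i j) (lt a b) (lt b a) (lt (σ ⟨$⟩ʳ a) (σ ⟨$⟩ʳ b)) (lt (σ ⟨$⟩ʳ b) (σ ⟨$⟩ʳ a))
    (λ i<j → let a≢b = permute-≢ π (lt⇒≢ i<j) in lt-flip a≢b , lt-flip (permute-≢ σ a≢b))
    where
    a = π ⟨$⟩ʳ i
    b = π ⟨$⟩ʳ j

  inversions-∘ : ∀ (π σ : Permutation′ n) → inversions (π ∘ₚ σ) % 2 ≡ (inversions π + inversions σ) % 2
  inversions-∘ π σ = begin
    inversions (π ∘ₚ σ) % 2              ≡⟨ [m+kn]%n≡m%n (inversions (π ∘ₚ σ)) M 2 ⟨
    (inversions (π ∘ₚ σ) + M * 2) % 2    ≡⟨ cong (λ k → (inversions (π ∘ₚ σ) + k) % 2) (*-comm M 2) ⟩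
    (inversions (π ∘ₚ σ) + 2 * M) % 2    ≡⟨ cong (λ k → (inversions (π ∘ₚ σ) + (M + k)) % 2) (+-identityʳ M) ⟩
    (inversions (π ∘ₚ σ) + (M + M)) % 2  ≡⟨ cong (_% 2) summed ⟩
    (inversions π + inversions σ) % 2    ∎
    where
    open ≡-Reasoning
    m = λ i j → inverts π i j * reversesAbove π σ i j
    M = ΣΣ m
    summed : inversions (π ∘ₚ σ) + (M + M) ≡ inversions π + inversions σ
    summed = begin
      inversions (π ∘ₚ σ) + (M + M)                        ≡⟨ cong₂ _+_ (inversions≡ΣΣ (π ∘ₚ σ)) (sym (ΣΣ-distrib-+ m m)) ⟩
      ΣΣ (inverts (π ∘ₚ σ)) + ΣΣ (λ i j → m i j + m i j)
        ≡⟨ sym (ΣΣ-distrib-+ (inverts (π ∘ₚ σ)) (λ i j → m i j + m i j)) ⟩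
      ΣΣ (λ i j → inverts (π ∘ₚ σ) i j + (m i j + m i j))  ≡⟨ sum-cong-≗ (λ i → sum-cong-≗ (inverts-∘ π σ i)) ⟩
      ΣΣ (λ i j → inverts π i j + reversesAbove π σ i j)   ≡⟨ ΣΣ-distrib-+ (inverts π) (reversesAbove π σ) ⟩
      ΣΣ (inverts π) + ΣΣ (reversesAbove π σ)               ≡⟨ cong₂ _+_ (sym (inversions≡ΣΣ π)) (ΣΣ-reversesAbove π σ) ⟩
      inversions π + inversions σ                           ∎

  Even-∘ : ∀ {π σ : Permutation′ n} → Even π → Even σ → Even (π ∘ₚ σ)
  Even-∘ {π = π} {σ} π-even σ-even = begin
    inversions (π ∘ₚ σ) % 2                             ≡⟨ inversions-∘ π σ ⟩
    (inversions π + inversions σ) % 2                   ≡⟨ %-distribˡ-+ (inversions π) (inversions σ) 2 ⟩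
    ((inversions π % 2) + (inversions σ % 2)) % 2       ≡⟨ cong₂ (λ a b → (a + b) % 2) π-even σ-even ⟩
    0                                                   ∎
    where open ≡-Reasoning

  inversions-cong : ∀ {π σ : Permutation′ n} → π ≈ₚ σ → inversions π ≡ inversions σ
  inversions-cong {π = π} {σ} π≈σ = begin
    inversions π       ≡⟨ inversions≡ΣΣ π ⟩
    ΣΣ (inverts π)     ≡⟨ sum-cong-≗ (λ i → sum-cong-≗ (λ j →
                            cong₂ (λ a b → when (lt i j) (indicator (lt a b))) (π≈σ j) (π≈σ i))) ⟩
    ΣΣ (inverts σ)     ≡⟨ inversions≡ΣΣ σ ⟨
    inversions σ       ∎
    where open ≡-Reasoning

  Even-resp : ∀ {π σ : Permutation′ n} → π ≈ₚ σ → Even π → Even σ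
  Even-resp {π = π} {σ} π≈σ π-even = trans (cong (_% 2) (sym (inversions-cong {π = π} {σ} π≈σ))) π-even

  inversions-id : inversions (idₚ {n}) ≡ 0
  inversions-id {n} = begin
    inversions (idₚ {n})     ≡⟨ inversions≡ΣΣ (idₚ {n}) ⟩
    ΣΣ (inverts (idₚ {n}))   ≡⟨ sum-cong-≗ (λ i → sum-cong-≗ (λ j → no-inversion i j)) ⟩
    ∑ {n} (λ _ → ∑ {n} (λ _ → 0)) ≡⟨ sum-cong-≗ {n} (λ _ → sum-replicate-zero n) ⟩
    ∑ {n} (λ _ → 0)          ≡⟨ sum-replicate-zero n ⟩
    0                        ∎
    where
    open ≡-Reasoning
    bits : ∀ x y → (x ≡ true → y ≡ not x) → when x (indicator y) ≡ 0
    bits false y _ = refl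
    bits true  y flip with flip refl
    ... | refl = refl
    no-inversion : ∀ (i j : Fin n) → inverts idₚ i j ≡ 0
    no-inversion i j = bits (lt i j) (lt j i) (λ i<j → lt-flip {a = i} {j} (lt⇒≢ i<j))

  Even-flip : ∀ {π : Permutation′ n} → Even π → Even (flip π)
  Even-flip {n} {π} π-even = begin
    inversions (flip π) % 2                                ≡⟨ m%n%n≡m%n (inversions (flip π)) 2 ⟨
    (0 + (inversions (flip π) % 2)) % 2                    ≡⟨ cong (λ a → (a + (inversions (flip π) % 2)) % 2) π-even ⟨
    ((inversions π % 2) + (inversions (flip π) % 2)) % 2   ≡⟨ %-distribˡ-+ (inversions π) (inversions (flip π)) 2 ⟨
    (inversions π + inversions (flip π)) % 2               ≡⟨ inversions-∘ π (flip π) ⟨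
    inversions (π ∘ₚ flip π) % 2
      ≡⟨ cong (_% 2) (inversions-cong {π = π ∘ₚ flip π} {idₚ} (λ i → inverseˡ π)) ⟩
    inversions (idₚ {n}) % 2                                   ≡⟨ cong (_% 2) (inversions-id {n}) ⟩
    0                                                      ∎
    where open ≡-Reasoning

module GroupSolver where

  open import Data.Bool using (Bool; true; false; not; if_then_else_; _∧_; _xor_; T)
  open import Data.Nat using (ℕ)
  open import Data.Fin using (Fin; _≟_)
  open import Data.List using (List; []; _∷_)
  open import Data.Product using (_×_; _,_)
  open import Data.Vec using (Vec; lookup)
  open import Relation.Nullary using (isYes)
  open import Relation.Nullary.Decidable using (toWitness)
  open import Relation.Binary.PropositionalEquality as ≡ using (_≡_)
  open import Algebra.Bundles using (Group)
  import Algebra.Properties.Group as GroupProperties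
  import Relation.Binary.Reasoning.Setoid as SetoidReasoning

  infixl 7 _⊙_
  data Expr (n : ℕ) : Set where
    var : Fin n → Expr n
    _⊙_ : Expr n → Expr n → Expr n
    inv : Expr n → Expr n
    one : Expr n

  Letter : ℕ → Set
  Letter n = Bool × Fin n

  module _ {n : ℕ} where

    cancels : Letter n → Letter n → Bool
    cancels (b , i) (b′ , i′) = (b xor b′) ∧ isYes (i ≟ i′)

    push : Letter n → List (Letter n) → List (Letter n)
    push x []      = x ∷ []
    push x (y ∷ w) = if cancels x y then w else x ∷ y ∷ w

    _++ʳ_ : List (Letter n) → List (Letter n) → List (Letter n)
    []      ++ʳ v = v
    (x ∷ w) ++ʳ v = push x (w ++ʳ v)

    invert : List (Letter n) → List (Letter n)
    invert []            = []
    invert ((b , i) ∷ w) = invert w ++ʳ ((not b , i) ∷ [])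

    normalise : Expr n → List (Letter n)
    normalise (var i) = (true , i) ∷ []
    normalise (a ⊙ b) = normalise a ++ʳ normalise b
    normalise (inv a) = invert (normalise a)
    normalise one     = []

  module Solve {c ℓ} (G : Group c ℓ) where
    open Group G
    open GroupProperties G
    open SetoidReasoning setoid

    module _ {n : ℕ} (env : Vec Carrier n) where

      ⟦_⟧ : Expr n → Carrier
      ⟦ var i ⟧ = lookup env i
      ⟦ a ⊙ b ⟧ = ⟦ a ⟧ ∙ ⟦ b ⟧
      ⟦ inv a ⟧ = ⟦ a ⟧ ⁻¹
      ⟦ one ⟧   = ε

      ⟦_⟧ₗ : Letter n → Carrier
      ⟦ true  , i ⟧ₗ = lookup env i
      ⟦ false , i ⟧ₗ = lookup env i ⁻¹

      ⟦_⟧ʷ : List (Letter n) → Carrier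
      ⟦ [] ⟧ʷ    = ε
      ⟦ x ∷ w ⟧ʷ = ⟦ x ⟧ₗ ∙ ⟦ w ⟧ʷ

      cancels-sound : ∀ x y → T (cancels x y) → ⟦ x ⟧ₗ ∙ ⟦ y ⟧ₗ ≈ ε
      cancels-sound (true  , i) (false , i′) i≡i′ with toWitness {a? = i ≟ i′} i≡i′
      ... | ≡.refl = inverseʳ _
      cancels-sound (false , i) (true  , i′) i≡i′ with toWitness {a? = i ≟ i′} i≡i′
      ... | ≡.refl = inverseˡ _

      push-sound : ∀ x w → ⟦ push x w ⟧ʷ ≈ ⟦ x ⟧ₗ ∙ ⟦ w ⟧ʷ
      push-sound x []      = refl
      push-sound x (y ∷ w) with cancels x y in eq
      ... | true  = begin
        ⟦ w ⟧ʷ                       ≈⟨ identityˡ _ ⟨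
        ε ∙ ⟦ w ⟧ʷ                   ≈⟨ ∙-congʳ (cancels-sound x y (≡.subst T (≡.sym eq) _)) ⟨
        (⟦ x ⟧ₗ ∙ ⟦ y ⟧ₗ) ∙ ⟦ w ⟧ʷ   ≈⟨ assoc _ _ _ ⟩
        ⟦ x ⟧ₗ ∙ (⟦ y ⟧ₗ ∙ ⟦ w ⟧ʷ)   ∎
      ... | false = refl

      ++ʳ-sound : ∀ w v → ⟦ w ++ʳ v ⟧ʷ ≈ ⟦ w ⟧ʷ ∙ ⟦ v ⟧ʷ
      ++ʳ-sound []      v = sym (identityˡ _)
      ++ʳ-sound (x ∷ w) v = begin
        ⟦ push x (w ++ʳ v) ⟧ʷ          ≈⟨ push-sound x (w ++ʳ v) ⟩
        ⟦ x ⟧ₗ ∙ ⟦ w ++ʳ v ⟧ʷ          ≈⟨ ∙-congˡ (++ʳ-sound w v) ⟩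
        ⟦ x ⟧ₗ ∙ (⟦ w ⟧ʷ ∙ ⟦ v ⟧ʷ)     ≈⟨ assoc _ _ _ ⟨
        (⟦ x ⟧ₗ ∙ ⟦ w ⟧ʷ) ∙ ⟦ v ⟧ʷ     ∎

      invert-letter : ∀ b i → ⟦ not b , i ⟧ₗ ≈ ⟦ b , i ⟧ₗ ⁻¹
      invert-letter true  i = refl
      invert-letter false i = sym (⁻¹-involutive _)

      invert-sound : ∀ w → ⟦ invert w ⟧ʷ ≈ ⟦ w ⟧ʷ ⁻¹
      invert-sound []            = sym ε⁻¹≈ε
      invert-sound ((b , i) ∷ w) = begin
        ⟦ invert w ++ʳ ((not b , i) ∷ []) ⟧ʷ   ≈⟨ ++ʳ-sound (invert w) _ ⟩
        ⟦ invert w ⟧ʷ ∙ (⟦ not b , i ⟧ₗ ∙ ε)   ≈⟨ ∙-cong (invert-sound w) (trans (identityʳ _) (invert-letter b i)) ⟩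
        ⟦ w ⟧ʷ ⁻¹ ∙ ⟦ b , i ⟧ₗ ⁻¹               ≈⟨ ⁻¹-anti-homo-∙ _ _ ⟨
        (⟦ b , i ⟧ₗ ∙ ⟦ w ⟧ʷ) ⁻¹                ∎

      normalise-sound : ∀ e → ⟦ normalise e ⟧ʷ ≈ ⟦ e ⟧
      normalise-sound (var i) = identityʳ _
      normalise-sound (a ⊙ b) = trans (++ʳ-sound (normalise a) (normalise b)) (∙-cong (normalise-sound a) (normalise-sound b))
      normalise-sound (inv a) = trans (invert-sound (normalise a)) (⁻¹-cong (normalise-sound a))
      normalise-sound one     = refl

      solve : ∀ e₁ e₂ → normalise e₁ ≡ normalise e₂ → ⟦ e₁ ⟧ ≈ ⟦ e₂ ⟧
      solve e₁ e₂ eq = trans (sym (normalise-sound e₁)) (trans (reflexive (≡.cong ⟦_⟧ʷ eq)) (normalise-sound e₂))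

module Generated where

  open import Data.Bool using (Bool; true; false; not)
  open import Data.List using (List; []; _∷_; _++_)
  open import Data.List.Relation.Unary.All as All using (All; []; _∷_)
  open import Data.List.Relation.Unary.All.Properties using (++⁺)
  open import Data.List.Relation.Unary.Any as Any using (Any)
  open import Data.List.Membership.Propositional using (_∈_; find)
  open import Data.Product using (_×_; _,_; proj₁; proj₂)
  open import Relation.Unary using (Pred)
  open import Algebra.Bundles using (Group)
  import Algebra.Properties.Group as GroupProperties
  import Relation.Binary.Reasoning.Setoid as SetoidReasoning
  open import Defs using (module RG)

  module _ {c ℓ} (G : Group c ℓ) where
    open Group G
    open GroupProperties G
    open RG rawGroup using (evalW; Gen)
    open SetoidReasoning setoid

    evalW-++ : ∀ w v → evalW (w ++ v) ≈ evalW w ∙ evalW v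
    evalW-++ []              v = sym (identityˡ _)
    evalW-++ ((true , a) ∷ w)  v = trans (∙-congˡ (evalW-++ w v)) (sym (assoc _ _ _))
    evalW-++ ((false , a) ∷ w) v = trans (∙-congˡ (evalW-++ w v)) (sym (assoc _ _ _))

    letter : Bool × Carrier → Carrier
    letter (true  , a) = a
    letter (false , a) = a ⁻¹

    evalW-∷ : ∀ x w → evalW (x ∷ w) ≈ letter x ∙ evalW w
    evalW-∷ (true  , a) w = refl
    evalW-∷ (false , a) w = refl

    invertW : List (Bool × Carrier) → List (Bool × Carrier)
    invertW []            = []
    invertW ((b , a) ∷ w) = invertW w ++ ((not b , a) ∷ [])

    letter-not : ∀ b a → letter (not b , a) ≈ letter (b , a) ⁻¹
    letter-not true  a = refl
    letter-not false a = sym (⁻¹-involutive a)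

    evalW-invertW : ∀ w → evalW (invertW w) ≈ evalW w ⁻¹
    evalW-invertW []            = sym ε⁻¹≈ε
    evalW-invertW ((b , a) ∷ w) = begin
      evalW (invertW w ++ ((not b , a) ∷ []))        ≈⟨ evalW-++ (invertW w) _ ⟩
      evalW (invertW w) ∙ evalW ((not b , a) ∷ [])   ≈⟨ ∙-cong (evalW-invertW w) (trans (evalW-∷ (not b , a) []) (identityʳ _)) ⟩
      evalW w ⁻¹ ∙ letter (not b , a)                ≈⟨ ∙-congˡ (letter-not b a) ⟩
      evalW w ⁻¹ ∙ letter (b , a) ⁻¹                 ≈⟨ ⁻¹-anti-homo-∙ _ _ ⟨
      (letter (b , a) ∙ evalW w) ⁻¹                  ≈⟨ ⁻¹-cong (evalW-∷ (b , a) w) ⟨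
      evalW ((b , a) ∷ w) ⁻¹                         ∎

    module _ {ℓ′} {S : Pred Carrier ℓ′} where

      Gen-resp : ∀ {x y} → x ≈ y → Gen S x → Gen S y
      Gen-resp x≈y (w , w∈S , w≈x) = w , w∈S , trans w≈x x≈y

      Gen-ε : Gen S ε
      Gen-ε = [] , [] , refl

      Gen-generator : ∀ {x} → S x → Gen S x
      Gen-generator x∈S = (true , _) ∷ [] , x∈S ∷ [] , identityʳ _

      Gen-∙ : ∀ {x y} → Gen S x → Gen S y → Gen S (x ∙ y)
      Gen-∙ (w , w∈S , w≈x) (v , v∈S , v≈y) = w ++ v , ++⁺ w∈S v∈S , trans (evalW-++ w v) (∙-cong w≈x v≈y)

      Gen-⁻¹ : ∀ {x} → Gen S x → Gen S (x ⁻¹)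
      Gen-⁻¹ (w , w∈S , w≈x) = invertW w , invertW-All w w∈S , trans (evalW-invertW w) (⁻¹-cong w≈x)
        where
        invertW-All : ∀ w → All (λ p → S (proj₂ p)) w → All (λ p → S (proj₂ p)) (invertW w)
        invertW-All []      []         = []
        invertW-All (_ ∷ w) (a∈S ∷ w∈S) = ++⁺ (invertW-All w w∈S) (a∈S ∷ [])

    Gen-mono : ∀ {ℓ₁ ℓ₂} {S : Pred Carrier ℓ₁} {T : Pred Carrier ℓ₂} →
               (∀ {x} → S x → T x) → ∀ {x} → Gen S x → Gen T x
    Gen-mono S⊆T (w , w∈S , w≈x) = w , All.map S⊆T w∈S , w≈x

    Gen⇒listed : ∀ {a ℓ′} {A : Set a} {S : Pred Carrier ℓ′} (f : A → Carrier) (L : List A) →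
      Any (λ l → ε ≈ f l) L →
      (∀ {s l} → S s → l ∈ L → Any (λ l′ → s ∙ f l ≈ f l′) L × Any (λ l′ → s ⁻¹ ∙ f l ≈ f l′) L) →
      ∀ {x} → Gen S x → Any (λ l → x ≈ f l) L
    Gen⇒listed {S = S} f L ε∈L closed (w , w∈S , w≈x) = Any.map (trans (sym w≈x)) (word w w∈S)
      where
      word : ∀ w → All (λ p → S (proj₂ p)) w → Any (λ l → evalW w ≈ f l) L
      word []            []          = ε∈L
      word ((b , a) ∷ w) (a∈S ∷ w∈S) with find (word w w∈S)
      ... | l , l∈L , w≈l = Any.map (trans (trans (evalW-∷ (b , a) w) (∙-congˡ w≈l))) (step b (closed a∈S l∈L))
        where
        step : ∀ b → _ → Any (λ l′ → letter (b , a) ∙ f l ≈ f l′) L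
        step true  = proj₁
        step false = proj₂

module Petersen where

  open import Data.Fin using (Fin; _≟_)
  open import Data.Fin.Properties using (<-cmp; all?)
  open import Data.Fin.Patterns using (0F; 1F)
  open import Data.Nat using (s≤s; z≤n)
  open import Data.Product using (_×_; _,_; proj₁)
  open import Data.Product.Properties using (≡-dec)
  open import Data.Sum using (_⊎_)
  open import Function.Bundles using (_⇔_; mk⇔)
  open import Relation.Nullary using (¬_; Dec)
  open import Relation.Nullary.Decidable using (from-yes; _×-dec_; _⊎-dec_; _→-dec_; ¬?)
  open import Relation.Binary using (tri<; tri≈; tri>)
  open import Relation.Binary.PropositionalEquality using (_≡_; _≢_; refl)
  open import Defs using (PetV; PetEq; PetAdj)

  -- The vertex {a, b}; a junk vertex when a = b.
  pair : Fin 5 → Fin 5 → PetV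
  pair a b with <-cmp a b
  ... | tri< a<b _ _ = (a , b) , a<b
  ... | tri≈ _ _ _   = (0F , 1F) , s≤s z≤n
  ... | tri> _ _ b<a = (b , a) , b<a

  SameSet : Fin 5 → Fin 5 → Fin 5 → Fin 5 → Set
  SameSet a b c d = (a ≡ c × b ≡ d) ⊎ (a ≡ d × b ≡ c)

  Disjoint : Fin 5 → Fin 5 → Fin 5 → Fin 5 → Set
  Disjoint a b c d = a ≢ c × a ≢ d × b ≢ c × b ≢ d

  private
    sameSet? : ∀ a b c d → Dec (SameSet a b c d)
    sameSet? a b c d = (a ≟ c ×-dec b ≟ d) ⊎-dec (a ≟ d ×-dec b ≟ c)

    disjoint? : ∀ a b c d → Dec (Disjoint a b c d)
    disjoint? a b c d = ¬? (a ≟ c) ×-dec ¬? (a ≟ d) ×-dec ¬? (b ≟ c) ×-dec ¬? (b ≟ d)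

    PetEq? : ∀ p q → Dec (PetEq p q)
    PetEq? p q = ≡-dec _≟_ _≟_ (proj₁ p) (proj₁ q)

    PetAdj? : ∀ p q → Dec (PetAdj p q)
    PetAdj? ((a , b) , _) ((c , d) , _) = disjoint? a b c d

    Pairs : (Fin 5 → Fin 5 → Fin 5 → Fin 5 → Set) → Set
    Pairs R = ∀ a b c d → a ≢ b → c ≢ d → R a b c d

    pairs? : ∀ {R} → (∀ a b c d → Dec (R a b c d)) → Dec (Pairs R)
    pairs? R? = all? λ a → all? λ b → all? λ c → all? λ d → ¬? (a ≟ b) →-dec ¬? (c ≟ d) →-dec R? a b c d

  opaque
    pair-sameSet : ∀ a b c d → a ≢ b → c ≢ d → PetEq (pair a b) (pair c d) ⇔ SameSet a b c d
    pair-sameSet a b c d a≢b c≢d = mk⇔ (to a b c d a≢b c≢d) (from a b c d a≢b c≢d)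
      where
      to : Pairs λ a b c d → PetEq (pair a b) (pair c d) → SameSet a b c d
      to = from-yes (pairs? λ a b c d → PetEq? (pair a b) (pair c d) →-dec sameSet? a b c d)
      from : Pairs λ a b c d → SameSet a b c d → PetEq (pair a b) (pair c d)
      from = from-yes (pairs? λ a b c d → sameSet? a b c d →-dec PetEq? (pair a b) (pair c d))

    pair-disjoint : ∀ a b c d → a ≢ b → c ≢ d → PetAdj (pair a b) (pair c d) ⇔ Disjoint a b c d
    pair-disjoint a b c d a≢b c≢d = mk⇔ (to a b c d a≢b c≢d) (from a b c d a≢b c≢d)
      where
      to : Pairs λ a b c d → PetAdj (pair a b) (pair c d) → Disjoint a b c d
      to = from-yes (pairs? λ a b c d → PetAdj? (pair a b) (pair c d) →-dec disjoint? a b c d)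
      from : Pairs λ a b c d → Disjoint a b c d → PetAdj (pair a b) (pair c d)
      from = from-yes (pairs? λ a b c d → disjoint? a b c d →-dec PetAdj? (pair a b) (pair c d))

  PetAdj-resp : ∀ {p p′ q q′} → PetEq p p′ → PetEq q q′ → PetAdj p′ q′ → PetAdj p q
  PetAdj-resp {(a , b) , _} {(.a , .b) , _} {(c , d) , _} {(.c , .d) , _} refl refl adj = adj

module Symbolic where

  open import Data.Fin using (Fin)
  open import Data.Fin.Patterns using (0F; 1F; 2F; 3F; 4F)
  import Data.Fin.Properties as Fin
  open import Data.Fin.Permutation using (Permutation′; _⟨$⟩ʳ_; _⟨$⟩ˡ_; _∘ₚ_; flip)
    renaming (_≈_ to _≈ₚ_; id to idₚ)
  open import Data.List using (List; []; _∷_; map; concatMap)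
  open import Data.List.Relation.Unary.All using (All; all?)
  open import Data.List.Relation.Unary.Any using (Any; any?)
  import Data.List.Properties as List
  open import Data.Product using (_×_; _,_; proj₁; proj₂)
  open import Relation.Nullary using (Dec; yes; no)
  open import Relation.Nullary.Decidable using (_×-dec_)
  open import Relation.Binary using (Decidable; DecidableEquality)
  open import Relation.Binary.PropositionalEquality using (_≡_; refl)
  open import Defs using (cyc123; perm12-45; perm14-25)
  open Permutations using (_≈ₚ?_)

  -- Reduced words in the free product ⟨μ⟩ * ⟨λ⟩ ≅ C₂ * C₃, written with the letters m = μ, l = λ, l² = λ⁻¹.
  data Letter : Set where
    m l l² : Letter

  _≟ᴸ_ : DecidableEquality Letter
  m  ≟ᴸ m  = yes refl
  l  ≟ᴸ l  = yes refl
  l² ≟ᴸ l² = yes refl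
  m  ≟ᴸ l  = no λ ()
  m  ≟ᴸ l² = no λ ()
  l  ≟ᴸ m  = no λ ()
  l  ≟ᴸ l² = no λ ()
  l² ≟ᴸ m  = no λ ()
  l² ≟ᴸ l  = no λ ()

  Word : Set
  Word = List Letter

  push : Letter → Word → Word
  push m  (m  ∷ w) = w
  push l  (l  ∷ w) = l² ∷ w
  push l  (l² ∷ w) = w
  push l² (l  ∷ w) = w
  push l² (l² ∷ w) = l ∷ w
  push x  w        = x ∷ w

  infixr 5 _·ʷ_
  _·ʷ_ : Word → Word → Word
  []      ·ʷ v = v
  (x ∷ w) ·ʷ v = push x (w ·ʷ v)

  invertᴸ : Letter → Letter
  invertᴸ m  = m
  invertᴸ l  = l²
  invertᴸ l² = l

  invertʷ : Word → Word
  invertʷ []      = []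
  invertʷ (x ∷ w) = invertʷ w ·ʷ (invertᴸ x ∷ [])

  -- Symbolic elements of (C₂ * C₃) ≀ S₅, multiplied by the same formulas as P ≀ S₅.
  Sym : Set
  Sym = (Fin 5 → Word) × Permutation′ 5

  infixl 7 _⊗_
  _⊗_ : Sym → Sym → Sym
  s ⊗ t = (λ i → proj₁ s i ·ʷ proj₁ t (proj₂ s ⟨$⟩ʳ i)) , (proj₂ s ∘ₚ proj₂ t)

  infix 8 _⁻ˢ
  _⁻ˢ : Sym → Sym
  s ⁻ˢ = (λ j → invertʷ (proj₁ s (proj₂ s ⟨$⟩ˡ j))) , flip (proj₂ s)

  idˢ : Sym
  idˢ = (λ _ → []) , idₚ

  infix 4 _≐_ _≈ᵖ_
  _≐_ : Sym → Sym → Set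
  s ≐ t = (∀ i → proj₁ s i ≡ proj₁ t i) × proj₂ s ≈ₚ proj₂ t

  _≈ᵖ_ : Sym → Sym → Set
  s ≈ᵖ t = proj₂ s ≈ₚ proj₂ t

  infix 4 _≐?_ _≈ᵖ?_
  _≈ᵖ?_ : Decidable _≈ᵖ_
  s ≈ᵖ? t = proj₂ s ≈ₚ? proj₂ t

  _≐?_ : Decidable _≐_
  s ≐? t = Fin.all? (λ i → List.≡-dec _≟ᴸ_ (proj₁ s i) (proj₁ t i)) ×-dec (s ≈ᵖ? t)

  h₁ˢ h₂ˢ gˢ : Sym
  h₁ˢ = (λ { 0F → [] ; 1F → [] ; 2F → [] ; 3F → l ∷ [] ; 4F → l² ∷ [] }) , cyc123
  h₂ˢ = (λ { 0F → m ∷ [] ; 1F → m ∷ [] ; 2F → m ∷ [] ; 3F → [] ; 4F → [] }) , perm12-45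
  gˢ  = (λ { 0F → [] ; 1F → m ∷ [] ; 2F → [] ; 3F → [] ; 4F → m ∷ [] }) , perm14-25

  products : List Sym → List Sym → List Sym
  products A B = concatMap (λ a → map (a ⊗_) B) A

  H₁ˢ H₂ˢ Hˢ : List Sym
  H₁ˢ = idˢ ∷ h₁ˢ ∷ h₁ˢ ⊗ h₁ˢ ∷ []
  H₂ˢ = idˢ ∷ h₂ˢ ∷ []
  Hˢ  = products H₁ˢ H₂ˢ

  Closed : List Sym → List Sym → Set
  Closed gens L = All (λ s → All (λ t → Any (s ⊗ t ≐_) L × Any (s ⁻ˢ ⊗ t ≐_) L) L) gens

  closed? : ∀ gens L → Dec (Closed gens L)
  closed? gens L = all? (λ s → all? (λ t → any? (s ⊗ t ≐?_) L ×-dec any? (s ⁻ˢ ⊗ t ≐?_) L) L) gens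

module Construction {c ℓ} (P : Group c ℓ) (μ lam : Group.Carrier P)
  (μ² : Group._≈_ P (Group._∙_ P μ μ) (Group.ε P))
  (λ³ : Group._≈_ P (Group._∙_ P lam (Group._∙_ P lam lam)) (Group.ε P)) where

  module WreathGroup where

    open import Data.Fin.Permutation using (_⟨$⟩ʳ_; _⟨$⟩ˡ_; inverseˡ; inverseʳ)
    open import Data.Product using (_,_; proj₁; proj₂)
    open import Relation.Binary.PropositionalEquality as ≡ using (cong)
    open import Algebra.Structures using (IsGroup)
    open import Defs using (module Wreath)
    open Parity using (Even-∘; Even-flip; Even-resp)
    open Permutations using (flip-cong)

    open Wreath P μ lam
    private module P = Group P

    -- X._≈_ unfolds to a product, from which Agda cannot recover its arguments; the record
    -- makes the equality usable with implicit arguments.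
    infix 4 _≋_
    record _≋_ (x y : Elem) : Set ℓ where
      constructor wrap
      field unwrap : x X.≈ y
    open _≋_ public

    private
      inverseˡ-coord : ∀ (x : Elem) j → (proj₁ x (proj₂ x ⟨$⟩ˡ j) P.⁻¹) P.∙ proj₁ x (proj₂ x ⟨$⟩ˡ j) P.≈ P.ε
      inverseˡ-coord x j = P.inverseˡ _

      inverseʳ-coord : ∀ (x : Elem) i → proj₁ x i P.∙ (proj₁ x (proj₂ x ⟨$⟩ˡ (proj₂ x ⟨$⟩ʳ i)) P.⁻¹) P.≈ P.ε
      inverseʳ-coord x i = P.trans (P.∙-congˡ (P.⁻¹-cong (P.reflexive (cong (proj₁ x) (inverseˡ (proj₂ x)))))) (P.inverseʳ _)

    X-isGroup : IsGroup _≋_ X._∙_ X.ε X._⁻¹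
    X-isGroup = record
      { isMonoid = record
        { isSemigroup = record
          { isMagma = record
            { isEquivalence = record
              { refl  = wrap ((λ _ → P.refl) , (λ _ → ≡.refl))
              ; sym   = λ (wrap (x≈y , πx≈πy)) → wrap ((λ i → P.sym (x≈y i)) , (λ i → ≡.sym (πx≈πy i)))
              ; trans = λ (wrap (x≈y , πx≈πy)) (wrap (y≈z , πy≈πz)) →
                          wrap ((λ i → P.trans (x≈y i) (y≈z i)) , (λ i → ≡.trans (πx≈πy i) (πy≈πz i)))
              }
            ; ∙-cong = λ {x} {y} {u} {v} (wrap (x≈y , πx≈πy)) (wrap (u≈v , πu≈πv)) → wrap
                ( (λ i → P.∙-cong (x≈y i) (P.trans (u≈v _) (P.reflexive (cong (proj₁ v) (πx≈πy i)))))
                , (λ i → ≡.trans (cong (proj₂ u ⟨$⟩ʳ_) (πx≈πy i)) (πu≈πv _)) )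
            }
          ; assoc = λ _ _ _ → wrap ((λ _ → P.assoc _ _ _) , (λ _ → ≡.refl))
          }
        ; identity = (λ _ → wrap ((λ _ → P.identityˡ _) , (λ _ → ≡.refl)))
                   , (λ _ → wrap ((λ _ → P.identityʳ _) , (λ _ → ≡.refl)))
        }
      ; inverse = (λ x → wrap (inverseˡ-coord x , (λ _ → inverseʳ (proj₂ x))))
                , (λ x → wrap (inverseʳ-coord x , (λ _ → inverseˡ (proj₂ x))))
      ; ⁻¹-cong = λ {x} {y} (wrap (x≈y , πx≈πy)) → wrap
          ( (λ j → P.⁻¹-cong (P.trans (x≈y _) (P.reflexive (cong (proj₁ y) (flip-cong {π = proj₂ x} {proj₂ y} πx≈πy j)))))
          , flip-cong {π = proj₂ x} {proj₂ y} πx≈πy )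
      }

    XG : Group c ℓ
    XG = record { isGroup = X-isGroup }

    -- X._∙_ reduces to a pair as soon as it is applied, so the multiplier cannot be inferred.
    ∙-congˡ : ∀ z {x y} → x ≋ y → z X.∙ x ≋ z X.∙ y
    ∙-congˡ z = Group.∙-congˡ XG {z}

    ∙-congʳ : ∀ z {x y} → x ≋ y → x X.∙ z ≋ y X.∙ z
    ∙-congʳ z = Group.∙-congʳ XG {z}

    InX-∙ : ∀ {x y} → InX x → InX y → InX (x X.∙ y)
    InX-∙ {x} {y} = Even-∘ {π = proj₂ x} {proj₂ y}

    InX-⁻¹ : ∀ {x} → InX x → InX (x X.⁻¹)
    InX-⁻¹ {x} = Even-flip {π = proj₂ x}

    InX-resp : ∀ {x y} → x ≋ y → InX x → InX y
    InX-resp {x} {y} (wrap (_ , πx≈πy)) = Even-resp {π = proj₂ x} {proj₂ y} πx≈πy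

  module Semantics where

    open import Data.Fin.Patterns using (0F; 1F; 2F; 3F; 4F)
    open import Data.Fin.Permutation using (_⟨$⟩ˡ_)
    open import Data.List using ([]; _∷_)
    open import Data.Product using (_,_; proj₁; proj₂)
    open import Relation.Binary.PropositionalEquality as ≡ using (cong)
    import Algebra.Properties.Group as GroupProperties
    import Relation.Binary.Reasoning.Setoid as SetoidReasoning
    open import Defs using (module Wreath)
    open Symbolic
    open WreathGroup using (XG; wrap)

    open Group P
    open GroupProperties P
    open Wreath P μ lam using (Elem; h₁; h₂; g)
    open SetoidReasoning setoid

    ⟦_⟧ᴸ : Letter → Carrier
    ⟦ m ⟧ᴸ  = μ
    ⟦ l ⟧ᴸ  = lam
    ⟦ l² ⟧ᴸ = lam ∙ lam

    ⟦_⟧ʷ : Word → Carrier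
    ⟦ [] ⟧ʷ    = ε
    ⟦ x ∷ w ⟧ʷ = ⟦ x ⟧ᴸ ∙ ⟦ w ⟧ʷ

    λ³′ : (lam ∙ lam) ∙ lam ≈ ε
    λ³′ = trans (assoc _ _ _) λ³

    cancel : ∀ {a b} w → a ∙ b ≈ ε → ⟦ w ⟧ʷ ≈ a ∙ (b ∙ ⟦ w ⟧ʷ)
    cancel w ab≈ε = begin
      ⟦ w ⟧ʷ              ≈⟨ identityˡ _ ⟨
      ε ∙ ⟦ w ⟧ʷ          ≈⟨ ∙-congʳ ab≈ε ⟨
      (_ ∙ _) ∙ ⟦ w ⟧ʷ    ≈⟨ assoc _ _ _ ⟩
      _ ∙ (_ ∙ ⟦ w ⟧ʷ)    ∎

    ⟦push⟧ : ∀ x w → ⟦ push x w ⟧ʷ ≈ ⟦ x ⟧ᴸ ∙ ⟦ w ⟧ʷ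
    ⟦push⟧ m  (m  ∷ w) = cancel w μ²
    ⟦push⟧ l  (l  ∷ w) = assoc _ _ _
    ⟦push⟧ l  (l² ∷ w) = cancel w λ³
    ⟦push⟧ l² (l  ∷ w) = cancel w λ³′
    ⟦push⟧ l² (l² ∷ w) = begin
      lam ∙ ⟦ w ⟧ʷ                            ≈⟨ ∙-congʳ (identityˡ lam) ⟨
      (ε ∙ lam) ∙ ⟦ w ⟧ʷ                      ≈⟨ ∙-congʳ (∙-congʳ λ³′) ⟨
      (((lam ∙ lam) ∙ lam) ∙ lam) ∙ ⟦ w ⟧ʷ    ≈⟨ ∙-congʳ (assoc _ _ _) ⟩
      ((lam ∙ lam) ∙ (lam ∙ lam)) ∙ ⟦ w ⟧ʷ    ≈⟨ assoc _ _ _ ⟩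
      (lam ∙ lam) ∙ ((lam ∙ lam) ∙ ⟦ w ⟧ʷ)    ∎
    ⟦push⟧ m  []       = refl
    ⟦push⟧ m  (l  ∷ w) = refl
    ⟦push⟧ m  (l² ∷ w) = refl
    ⟦push⟧ l  []       = refl
    ⟦push⟧ l  (m  ∷ w) = refl
    ⟦push⟧ l² []       = refl
    ⟦push⟧ l² (m  ∷ w) = refl

    ⟦·ʷ⟧ : ∀ w v → ⟦ w ·ʷ v ⟧ʷ ≈ ⟦ w ⟧ʷ ∙ ⟦ v ⟧ʷ
    ⟦·ʷ⟧ []      v = sym (identityˡ _)
    ⟦·ʷ⟧ (x ∷ w) v = begin
      ⟦ push x (w ·ʷ v) ⟧ʷ           ≈⟨ ⟦push⟧ x (w ·ʷ v) ⟩
      ⟦ x ⟧ᴸ ∙ ⟦ w ·ʷ v ⟧ʷ           ≈⟨ ∙-congˡ (⟦·ʷ⟧ w v) ⟩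
      ⟦ x ⟧ᴸ ∙ (⟦ w ⟧ʷ ∙ ⟦ v ⟧ʷ)     ≈⟨ assoc _ _ _ ⟨
      (⟦ x ⟧ᴸ ∙ ⟦ w ⟧ʷ) ∙ ⟦ v ⟧ʷ     ∎

    ⟦invertᴸ⟧ : ∀ x → ⟦ invertᴸ x ⟧ᴸ ≈ ⟦ x ⟧ᴸ ⁻¹
    ⟦invertᴸ⟧ m  = inverseʳ-unique μ μ μ²
    ⟦invertᴸ⟧ l  = inverseʳ-unique lam (lam ∙ lam) λ³
    ⟦invertᴸ⟧ l² = inverseʳ-unique (lam ∙ lam) lam λ³′

    ⟦invertʷ⟧ : ∀ w → ⟦ invertʷ w ⟧ʷ ≈ ⟦ w ⟧ʷ ⁻¹
    ⟦invertʷ⟧ []      = sym ε⁻¹≈ε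
    ⟦invertʷ⟧ (x ∷ w) = begin
      ⟦ invertʷ w ·ʷ (invertᴸ x ∷ []) ⟧ʷ      ≈⟨ ⟦·ʷ⟧ (invertʷ w) _ ⟩
      ⟦ invertʷ w ⟧ʷ ∙ (⟦ invertᴸ x ⟧ᴸ ∙ ε)   ≈⟨ ∙-cong (⟦invertʷ⟧ w) (trans (identityʳ _) (⟦invertᴸ⟧ x)) ⟩
      ⟦ w ⟧ʷ ⁻¹ ∙ ⟦ x ⟧ᴸ ⁻¹                     ≈⟨ ⁻¹-anti-homo-∙ _ _ ⟨
      (⟦ x ⟧ᴸ ∙ ⟦ w ⟧ʷ) ⁻¹                      ∎

    private module X = Group XG

    ⟦_⟧ : Sym → Elem
    ⟦ s ⟧ = (λ i → ⟦ proj₁ s i ⟧ʷ) , proj₂ s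

    ⟦⊗⟧ : ∀ s t → ⟦ s ⊗ t ⟧ X.≈ ⟦ s ⟧ X.∙ ⟦ t ⟧
    ⟦⊗⟧ s t = wrap ((λ i → ⟦·ʷ⟧ (proj₁ s i) _) , (λ _ → ≡.refl))

    ⟦⁻ˢ⟧ : ∀ s → ⟦ s ⁻ˢ ⟧ X.≈ ⟦ s ⟧ X.⁻¹
    ⟦⁻ˢ⟧ s = wrap ((λ j → ⟦invertʷ⟧ (proj₁ s (proj₂ s ⟨$⟩ˡ j))) , (λ _ → ≡.refl))

    ⟦idˢ⟧ : ⟦ idˢ ⟧ X.≈ X.ε
    ⟦idˢ⟧ = X.refl

    ⟦⟧-cong : ∀ {s t} → s ≐ t → ⟦ s ⟧ X.≈ ⟦ t ⟧
    ⟦⟧-cong (words≡ , perms≈) = wrap ((λ i → reflexive (cong ⟦_⟧ʷ (words≡ i))) , perms≈)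

    ⟦h₁ˢ⟧ : ⟦ h₁ˢ ⟧ X.≈ h₁
    ⟦h₁ˢ⟧ = wrap ((λ { 0F → refl ; 1F → refl ; 2F → refl ; 3F → identityʳ lam
                    ; 4F → trans (identityʳ _) (⟦invertᴸ⟧ l) }) , (λ _ → ≡.refl))

    ⟦h₂ˢ⟧ : ⟦ h₂ˢ ⟧ X.≈ h₂
    ⟦h₂ˢ⟧ = wrap ((λ { 0F → identityʳ μ ; 1F → identityʳ μ ; 2F → identityʳ μ ; 3F → refl ; 4F → refl })
                  , (λ _ → ≡.refl))

    ⟦gˢ⟧ : ⟦ gˢ ⟧ X.≈ g
    ⟦gˢ⟧ = wrap ((λ { 0F → refl ; 1F → identityʳ μ ; 2F → refl ; 3F → refl ; 4F → identityʳ μ }) , (λ _ → ≡.refl))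

  module Subgroups where

    open import Level using (_⊔_)
    open import Data.Nat using (zero; suc; _≤_; _<_; s≤s; z≤n)
    open import Data.Bool using (true; false)
    open import Data.List using (List; []; _∷_; map)
    open import Data.List.Relation.Unary.All as All using (All; []; _∷_; lookupAny; all?)
    open import Data.List.Relation.Unary.All.Properties as All using ()
    open import Data.List.Relation.Unary.Any as Any using (Any; here; there; any?)
    open import Data.List.Relation.Unary.Any.Properties as Any using ()
    open import Data.List.Membership.Propositional using (_∈_; find)
    open import Function using (_∘_)
    open import Data.Product using (Σ; ∃₂; _×_; _,_; proj₂)
    open import Function.Bundles using (_⇔_; mk⇔)
    open import Data.Sum using (_⊎_; inj₁; inj₂)
    open import Data.Fin.Patterns using (0F)
    open import Data.Fin.Permutation using (Permutation′; _∘ₚ_) renaming (_≈_ to _≈ₚ_)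
    open import Relation.Unary using (Pred)
    open import Relation.Nullary using (¬_)
    open import Relation.Nullary.Decidable using (from-yes; _→-dec_)
    open import Relation.Binary.PropositionalEquality as ≡ using (_≡_)
    import Relation.Binary.Reasoning.Setoid as SetoidReasoning
    open import Defs using (module RG; module Wreath; SymRaw)
    open import Data.Fin.Permutation using (_⟨$⟩ʳ_)
    open Permutations
    open Generated
    open WreathGroup using (XG; wrap; unwrap; ∙-congʳ)
    open Symbolic
    open Semantics

    open Wreath P μ lam
    module W = Group XG
    open SetoidReasoning W.setoid

    private
      variable
        ℓ′ : Level.Level
        S : Pred Elem ℓ′
        x y : Elem
        s t : Sym

    -- Defs measures membership in ⟨S⟩ with the raw equality X._≈_; the lemmas of Generated use W._≈_.
    evalW-≡ : ∀ w → RG.evalW (Group.rawGroup XG) w ≡ RG.evalW XRaw w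
    evalW-≡ []                = ≡.refl
    evalW-≡ ((true , a) ∷ w)  = ≡.cong (a X.∙_) (evalW-≡ w)
    evalW-≡ ((false , a) ∷ w) = ≡.cong (a X.⁻¹ X.∙_) (evalW-≡ w)

    infix 4 _∈⟨_⟩
    _∈⟨_⟩ : Elem → Pred Elem ℓ′ → Set (c ⊔ ℓ ⊔ ℓ′)
    x ∈⟨ S ⟩ = RG.Gen (Group.rawGroup XG) S x

    ⟨⟩-to : ∀ x → x ∈⟨ S ⟩ → XGen S x
    ⟨⟩-to x (w , w∈S , w≈x) = w , w∈S , ≡.subst (X._≈ x) (evalW-≡ w) (unwrap w≈x)

    ⟨⟩-from : ∀ x → XGen S x → x ∈⟨ S ⟩
    ⟨⟩-from x (w , w∈S , w≈x) = w , w∈S , wrap (≡.subst (X._≈ x) (≡.sym (evalW-≡ w)) w≈x)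

    -- Stated as a record so that the symbol s can be inferred from a proof of x ≈⟦ s ⟧.
    infix 4 _≈⟦_⟧
    record _≈⟦_⟧ (x : Elem) (s : Sym) : Set ℓ where
      constructor represents
      field represented : x W.≈ ⟦ s ⟧
    open _≈⟦_⟧ public

    _∈ˢ_ : Elem → List Sym → Set ℓ
    x ∈ˢ L = Any (x ≈⟦_⟧) L

    record Listing (S : Pred Elem ℓ′) (L : List Sym) : Set (c ⊔ ℓ ⊔ ℓ′) where
      field
        complete : ∀ {x} → x ∈⟨ S ⟩ → x ∈ˢ L
        sound    : All (λ t → ⟦ t ⟧ ∈⟨ S ⟩) L

    listing : ∀ (gens L : List Sym) → (∀ {x} → S x → x ∈ˢ gens) → All (λ t → ⟦ t ⟧ ∈⟨ S ⟩) L →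
              Closed gens L → Any (idˢ ≐_) L → Listing S L
    listing {S = S} gens L S⊆gens sound closed id∈L = record
      { complete = Any.map represents ∘
          Gen⇒listed XG ⟦_⟧ L (Any.map (λ id≐t → W.trans (W.sym ⟦idˢ⟧) (⟦⟧-cong id≐t)) id∈L) step
      ; sound    = sound
      }
      where
      step : ∀ {s t} → S s → t ∈ L →
             Any (λ u → s X.∙ ⟦ t ⟧ W.≈ ⟦ u ⟧) L × Any (λ u → s X.⁻¹ X.∙ ⟦ t ⟧ W.≈ ⟦ u ⟧) L
      step {s} {t} s∈S t∈L with find (S⊆gens s∈S)
      ... | r , r∈gens , represents s≈r with All.lookup (All.lookup closed r∈gens) t∈L
      ... | r⊗t∈L , r⁻⊗t∈L =
        Any.map (λ {u} r⊗t≐u → begin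
          s X.∙ ⟦ t ⟧       ≈⟨ ∙-congʳ ⟦ t ⟧ s≈r ⟩
          ⟦ r ⟧ X.∙ ⟦ t ⟧   ≈⟨ ⟦⊗⟧ r t ⟨
          ⟦ r ⊗ t ⟧         ≈⟨ ⟦⟧-cong r⊗t≐u ⟩
          ⟦ u ⟧             ∎) r⊗t∈L ,
        Any.map (λ {u} r⁻⊗t≐u → begin
          s X.⁻¹ X.∙ ⟦ t ⟧         ≈⟨ ∙-congʳ ⟦ t ⟧ (W.⁻¹-cong s≈r) ⟩
          ⟦ r ⟧ X.⁻¹ X.∙ ⟦ t ⟧     ≈⟨ ∙-congʳ ⟦ t ⟧ (⟦⁻ˢ⟧ r) ⟨
          ⟦ r ⁻ˢ ⟧ X.∙ ⟦ t ⟧       ≈⟨ ⟦⊗⟧ (r ⁻ˢ) t ⟨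
          ⟦ r ⁻ˢ ⊗ t ⟧             ≈⟨ ⟦⟧-cong r⁻⊗t≐u ⟩
          ⟦ u ⟧                    ∎) r⁻⊗t∈L

    infixl 7 _⊗≋_
    _⊗≋_ : x ≈⟦ s ⟧ → y ≈⟦ t ⟧ → x X.∙ y ≈⟦ s ⊗ t ⟧
    _⊗≋_ {s = s} {t = t} (represents x≈s) (represents y≈t) = represents (W.trans (W.∙-cong x≈s y≈t) (W.sym (⟦⊗⟧ s t)))

    infix 8 _⁻≋
    _⁻≋ : x ≈⟦ s ⟧ → x X.⁻¹ ≈⟦ s ⁻ˢ ⟧
    _⁻≋ {s = s} (represents x≈s) = represents (W.trans (W.⁻¹-cong x≈s) (W.sym (⟦⁻ˢ⟧ s)))

    ⟦⟧-represents : ∀ s → ⟦ s ⟧ ≈⟦ s ⟧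
    ⟦⟧-represents s = represents W.refl

    ≈ᵖ-of : x ≈⟦ s ⟧ → y ≈⟦ t ⟧ → x W.≈ y → s ≈ᵖ t
    ≈ᵖ-of (represents x≈s) (represents y≈t) x≈y = proj₂ (unwrap (W.trans (W.sym x≈s) (W.trans x≈y y≈t)))

    g≈gˢ : g ≈⟦ gˢ ⟧
    g≈gˢ = represents (W.sym ⟦gˢ⟧)

    ε≈idˢ : X.ε ≈⟦ idˢ ⟧
    ε≈idˢ = represents (W.sym ⟦idˢ⟧)

    ⟨⟩-⊗ : ∀ s t → ⟦ s ⟧ ∈⟨ S ⟩ → ⟦ t ⟧ ∈⟨ S ⟩ → ⟦ s ⊗ t ⟧ ∈⟨ S ⟩
    ⟨⟩-⊗ s t s∈⟨S⟩ t∈⟨S⟩ =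
      Gen-resp XG (represented (⟦⟧-represents s ⊗≋ ⟦⟧-represents t)) (Gen-∙ XG s∈⟨S⟩ t∈⟨S⟩)

    products-sound : ∀ {A B : List Sym} → All (λ t → ⟦ t ⟧ ∈⟨ S ⟩) A → All (λ t → ⟦ t ⟧ ∈⟨ S ⟩) B →
                     All (λ t → ⟦ t ⟧ ∈⟨ S ⟩) (products A B)
    products-sound {A = A} {B} A⊆⟨S⟩ B⊆⟨S⟩ =
      All.concat⁺ (All.map⁺ (All.tabulate λ {s} s∈A →
        All.map⁺ (All.tabulate λ {t} t∈B → ⟨⟩-⊗ s t (All.lookup A⊆⟨S⟩ s∈A) (All.lookup B⊆⟨S⟩ t∈B))))

    ⟨⟩-id : ⟦ idˢ ⟧ ∈⟨ S ⟩
    ⟨⟩-id = Gen-resp XG (W.sym ⟦idˢ⟧) (Gen-ε XG)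

    ⟨⟩-generator : ∀ {y} s → S y → y W.≈ ⟦ s ⟧ → ⟦ s ⟧ ∈⟨ S ⟩
    ⟨⟩-generator s y∈S y≈s = Gen-resp XG y≈s (Gen-generator XG y∈S)

    IsH₁ IsH₂ IsH : Pred Elem ℓ
    IsH₁ y = y X.≈ h₁
    IsH₂ y = y X.≈ h₂
    IsH  y = IsH₁ y ⊎ IsH₂ y

    h₁-listed : ∀ {L} → IsH₁ x → x ∈ˢ (h₁ˢ ∷ L)
    h₁-listed x≈h₁ = here (represents (W.trans (wrap x≈h₁) (W.sym ⟦h₁ˢ⟧)))

    h₂-listed : ∀ {L} → IsH₂ x → x ∈ˢ (h₂ˢ ∷ L)
    h₂-listed x≈h₂ = here (represents (W.trans (wrap x≈h₂) (W.sym ⟦h₂ˢ⟧)))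

    h₁∈⟨h₁⟩ : ⟦ h₁ˢ ⟧ ∈⟨ IsH₁ ⟩
    h₁∈⟨h₁⟩ = ⟨⟩-generator h₁ˢ (unwrap (W.refl {h₁})) (W.sym ⟦h₁ˢ⟧)

    h₂∈⟨h₂⟩ : ⟦ h₂ˢ ⟧ ∈⟨ IsH₂ ⟩
    h₂∈⟨h₂⟩ = ⟨⟩-generator h₂ˢ (unwrap (W.refl {h₂})) (W.sym ⟦h₂ˢ⟧)

    opaque
      listing-H₁ : Listing IsH₁ H₁ˢ
      listing-H₁ = listing (h₁ˢ ∷ []) H₁ˢ h₁-listed
        (⟨⟩-id ∷ h₁∈⟨h₁⟩ ∷ ⟨⟩-⊗ h₁ˢ h₁ˢ h₁∈⟨h₁⟩ h₁∈⟨h₁⟩ ∷ [])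
        (from-yes (closed? (h₁ˢ ∷ []) H₁ˢ)) (from-yes (any? (idˢ ≐?_) H₁ˢ))

    opaque
      listing-H₂ : Listing IsH₂ H₂ˢ
      listing-H₂ = listing (h₂ˢ ∷ []) H₂ˢ h₂-listed (⟨⟩-id ∷ h₂∈⟨h₂⟩ ∷ [])
        (from-yes (closed? (h₂ˢ ∷ []) H₂ˢ)) (from-yes (any? (idˢ ≐?_) H₂ˢ))

    ⟨h₁⟩⊆H : x ∈⟨ IsH₁ ⟩ → x ∈⟨ IsH ⟩
    ⟨h₁⟩⊆H = Gen-mono XG inj₁

    ⟨h₂⟩⊆H : x ∈⟨ IsH₂ ⟩ → x ∈⟨ IsH ⟩
    ⟨h₂⟩⊆H = Gen-mono XG inj₂

    opaque
      listing-H : Listing IsH Hˢ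
      listing-H = listing (h₁ˢ ∷ h₂ˢ ∷ []) Hˢ generators
        (products-sound (All.map ⟨h₁⟩⊆H (Listing.sound listing-H₁)) (All.map ⟨h₂⟩⊆H (Listing.sound listing-H₂)))
        (from-yes (closed? (h₁ˢ ∷ h₂ˢ ∷ []) Hˢ)) (from-yes (any? (idˢ ≐?_) Hˢ))
        where
        generators : IsH x → x ∈ˢ (h₁ˢ ∷ h₂ˢ ∷ [])
        generators (inj₁ x≈h₁) = h₁-listed x≈h₁
        generators (inj₂ x≈h₂) = there (h₂-listed x≈h₂)

    listed-member : ∀ {L} → Listing S L → Any (t ≐_) L → ⟦ t ⟧ ∈⟨ S ⟩
    listed-member {t = t} listed t∈L with find t∈L
    ... | u , u∈L , t≐u = Gen-resp XG (W.sym (⟦⟧-cong t≐u)) (All.lookup (Listing.sound listed) u∈L)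

    represent : ∀ {L} {p} {Q : Pred Sym p} → Listing S L → All Q L → x ∈⟨ S ⟩ → Σ Sym λ s → Q s × x ≈⟦ s ⟧
    represent listed checked x∈⟨S⟩ = _ , lookupAny checked (Listing.complete listed x∈⟨S⟩)

    opaque
      conjugates-in-H₁ : All (λ s → All (λ t → Any ((s ⁻ˢ ⊗ t ⊗ s) ≐_) H₁ˢ) H₁ˢ) Hˢ
      conjugates-in-H₁ = from-yes (all? (λ s → all? (λ t → any? ((s ⁻ˢ ⊗ t ⊗ s) ≐?_) H₁ˢ) H₁ˢ) Hˢ)

    ⟨h₁⟩-normal : ∀ a z → InH a → In⟨h₁⟩ z → In⟨h₁⟩ ((a X.⁻¹ X.∙ z) X.∙ a)
    ⟨h₁⟩-normal a z a∈H z∈⟨h₁⟩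
      with represent listing-H conjugates-in-H₁ (⟨⟩-from a a∈H)
    ... | s , s-ok , a≈s with represent listing-H₁ s-ok (⟨⟩-from z z∈⟨h₁⟩)
    ... | t , s⁻ts∈H₁ , z≈t =
      ⟨⟩-to _ (Gen-resp XG (W.sym (represented (a≈s ⁻≋ ⊗≋ z≈t ⊗≋ a≈s))) (listed-member listing-H₁ s⁻ts∈H₁))

    opaque
      H₁-H₂-share-only-identity : All (λ t → All (λ e → t ≈ᵖ e → t ≐ idˢ) H₂ˢ) H₁ˢ
      H₁-H₂-share-only-identity = from-yes (all? (λ t → all? (λ e → (t ≈ᵖ? e) →-dec (t ≐? idˢ)) H₂ˢ) H₁ˢ)

    ⟨h₁⟩∩⟨h₂⟩-trivial : ∀ z → In⟨h₁⟩ z → In⟨h₂⟩ z → z X.≈ X.ε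
    ⟨h₁⟩∩⟨h₂⟩-trivial z z∈⟨h₁⟩ z∈⟨h₂⟩
      with represent listing-H₁ H₁-H₂-share-only-identity (⟨⟩-from z z∈⟨h₁⟩)
    ... | t , t-ok , z≈t with represent listing-H₂ t-ok (⟨⟩-from z z∈⟨h₂⟩)
    ... | e , t≈ᵖe⇒t≐id , z≈e =
      unwrap (W.trans (represented z≈t) (W.trans (⟦⟧-cong (t≈ᵖe⇒t≐id (≈ᵖ-of z≈t z≈e W.refl))) ⟦idˢ⟧))

    H≡⟨h₁⟩⟨h₂⟩ : ∀ z → InH z → ∃₂ λ a b → In⟨h₁⟩ a × In⟨h₂⟩ b × (z X.≈ (a X.∙ b))
    H≡⟨h₁⟩⟨h₂⟩ z z∈H with find (Any.concatMap⁻ (λ a → map (a ⊗_) H₂ˢ) (Listing.complete listing-H (⟨⟩-from z z∈H)))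
    ... | s , s∈H₁ , z∈s⟨h₂⟩ with find (Any.map⁻ {f = s ⊗_} z∈s⟨h₂⟩)
    ... | t , t∈H₂ , represents z≈st =
      ⟦ s ⟧ , ⟦ t ⟧ ,
      ⟨⟩-to _ (All.lookup (Listing.sound listing-H₁) s∈H₁) , ⟨⟩-to _ (All.lookup (Listing.sound listing-H₂) t∈H₂) ,
      unwrap (W.trans z≈st (⟦⊗⟧ s t))

    g-order-2 : XHasOrder g 2
    g-order-2 = unwrap g² , nontrivial
      where
      g² : g X.∙ (g X.∙ X.ε) W.≈ X.ε
      g² = W.trans (represented (g≈gˢ ⊗≋ (g≈gˢ ⊗≋ ε≈idˢ)))
                   (W.trans (⟦⟧-cong (from-yes (gˢ ⊗ (gˢ ⊗ idˢ) ≐? idˢ))) ⟦idˢ⟧)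
      nontrivial : ∀ k → suc k < 2 → ¬ (RG.pow XRaw g (suc k) X.≈ X.ε)
      nontrivial zero _ (_ , g≈ₚid) with g≈ₚid 0F
      ... | ()
      nontrivial (suc k) (s≤s (s≤s ()))

    module _ {k} (k≤5 : k ≤ 5) where

      restrictₛ : Sym → Permutation′ k
      restrictₛ s = restriction k≤5 (proj₂ s)

      iso-to-symmetric : ∀ {L} → Listing S L →
        All (λ s → All (λ t → restrictₛ (s ⊗ t) ≈ₚ restrictₛ s ∘ₚ restrictₛ t) L) L →
        All (λ s → All (λ t → restrictₛ s ≈ₚ restrictₛ t → s ≐ t) L) L →
        All (λ σ → Any (λ t → restrictₛ t ≈ₚ σ) L) (perms k) →
        XIsoTo (XGen S) (SymRaw k)
      iso-to-symmetric {S = S} listed homomorphic injective surjective =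
        φ , φ-cong , φ-hom , φ-injective , φ-surjective
        where
        φ : Elem → Permutation′ k
        φ x = restriction k≤5 (proj₂ x)
        ≡⇒≈ₚ : ∀ {σ τ : Permutation′ k} → σ ≡ τ → σ ≈ₚ τ
        ≡⇒≈ₚ ≡.refl _ = ≡.refl
        φ-of : x ≈⟦ s ⟧ → φ x ≡ restrictₛ s
        φ-of {x = x} {s = s} x≈s = restriction-cong k≤5 {proj₂ x} {proj₂ s} (proj₂ (unwrap (represented x≈s)))
        φ-cong : ∀ a b → XGen S a → a X.≈ b → φ a ≈ₚ φ b
        φ-cong a b _ a≈b = ≡⇒≈ₚ (restriction-cong k≤5 {proj₂ a} {proj₂ b} (proj₂ a≈b))
        φ-hom : ∀ a b → XGen S a → XGen S b → φ (a X.∙ b) ≈ₚ φ a ∘ₚ φ b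
        φ-hom a b a∈⟨S⟩ b∈⟨S⟩ i with represent listed homomorphic (⟨⟩-from a a∈⟨S⟩)
        ... | s , s-ok , a≈s with represent listed s-ok (⟨⟩-from b b∈⟨S⟩)
        ... | t , st-ok , b≈t = ≡.trans (≡.cong (_⟨$⟩ʳ i) (φ-of (a≈s ⊗≋ b≈t)))
                                  (≡.trans (st-ok i) (≡.cong (_⟨$⟩ʳ i) (≡.sym (≡.cong₂ _∘ₚ_ (φ-of a≈s) (φ-of b≈t)))))
        φ-injective : ∀ a b → XGen S a → XGen S b → φ a ≈ₚ φ b → a X.≈ b
        φ-injective a b a∈⟨S⟩ b∈⟨S⟩ φa≈φb with represent listed injective (⟨⟩-from a a∈⟨S⟩)
        ... | s , s-ok , a≈s with represent listed s-ok (⟨⟩-from b b∈⟨S⟩)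
        ... | t , s≈t⇒s≐t , b≈t =
          unwrap (W.trans (represented a≈s) (W.trans (⟦⟧-cong (s≈t⇒s≐t restricts-equal)) (W.sym (represented b≈t))))
          where
          restricts-equal : restrictₛ s ≈ₚ restrictₛ t
          restricts-equal i = ≡.trans (≡.cong (_⟨$⟩ʳ i) (≡.sym (φ-of a≈s)))
                                (≡.trans (φa≈φb i) (≡.cong (_⟨$⟩ʳ i) (φ-of b≈t)))
        φ-surjective : ∀ σ → Σ Elem λ a → XGen S a × φ a ≈ₚ σ
        φ-surjective = ∀-perms
          (λ σ≈τ (a , a∈⟨S⟩ , φa≈τ) → a , a∈⟨S⟩ , λ i → ≡.trans (φa≈τ i) (≡.sym (σ≈τ i)))
          (All.map (λ t∈L → let t , t∈L′ , σ′ = find t∈L in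
                            ⟦ t ⟧ , ⟨⟩-to _ (All.lookup (Listing.sound listed) t∈L′) , σ′) surjective)

    3≤5 : 3 ≤ 5
    3≤5 = s≤s (s≤s (s≤s z≤n))

    2≤5 : 2 ≤ 5
    2≤5 = s≤s (s≤s z≤n)

    opaque
      H≅S₃ : XIsoTo InH (SymRaw 3)
      H≅S₃ = iso-to-symmetric 3≤5 listing-H
        (from-yes (all? (λ s → all? (λ t → restrictₛ 3≤5 (s ⊗ t) ≈ₚ? restrictₛ 3≤5 s ∘ₚ restrictₛ 3≤5 t) Hˢ) Hˢ))
        (from-yes (all? (λ s → all? (λ t → (restrictₛ 3≤5 s ≈ₚ? restrictₛ 3≤5 t) →-dec (s ≐? t)) Hˢ) Hˢ))
        (from-yes (all? (λ σ → any? (λ t → restrictₛ 3≤5 t ≈ₚ? σ) Hˢ) (perms 3)))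

    opaque
      ⟨h₂⟩≅S₂ : XIsoTo In⟨h₂⟩ (SymRaw 2)
      ⟨h₂⟩≅S₂ = iso-to-symmetric 2≤5 listing-H₂
        (from-yes (all? (λ s → all? (λ t → restrictₛ 2≤5 (s ⊗ t) ≈ₚ? restrictₛ 2≤5 s ∘ₚ restrictₛ 2≤5 t) H₂ˢ) H₂ˢ))
        (from-yes (all? (λ s → all? (λ t → (restrictₛ 2≤5 s ≈ₚ? restrictₛ 2≤5 t) →-dec (s ≐? t)) H₂ˢ) H₂ˢ))
        (from-yes (all? (λ σ → any? (λ t → restrictₛ 2≤5 t ≈ₚ? σ) H₂ˢ) (perms 2)))

    opaque
      H∩Hᵍ⊆⟨h₂⟩ : All (λ s → Any (λ k → gˢ ⊗ s ⊗ gˢ ⁻ˢ ≈ᵖ k) Hˢ → Any (s ≐_) H₂ˢ) Hˢ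
      H∩Hᵍ⊆⟨h₂⟩ = from-yes (all? (λ s → any? (λ k → gˢ ⊗ s ⊗ gˢ ⁻ˢ ≈ᵖ? k) Hˢ →-dec any? (s ≐?_) H₂ˢ) Hˢ)

      g-centralises-⟨h₂⟩ : All (λ e → gˢ ⊗ e ⊗ gˢ ⁻ˢ ≐ e) H₂ˢ
      g-centralises-⟨h₂⟩ = from-yes (all? (λ e → gˢ ⊗ e ⊗ gˢ ⁻ˢ ≐? e) H₂ˢ)

    H∩Hᵍ≡⟨h₂⟩ : ∀ z → (InH z × InH ((g X.∙ z) X.∙ (g X.⁻¹))) ⇔ In⟨h₂⟩ z
    H∩Hᵍ≡⟨h₂⟩ z = mk⇔ to from
      where
      to : InH z × InH ((g X.∙ z) X.∙ (g X.⁻¹)) → In⟨h₂⟩ z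
      to (z∈H , zᵍ∈H) with represent listing-H H∩Hᵍ⊆⟨h₂⟩ (⟨⟩-from z z∈H)
      ... | s , s-ok , z≈s
        with find (s-ok (Any.map (λ zᵍ≈k → ≈ᵖ-of (g≈gˢ ⊗≋ z≈s ⊗≋ g≈gˢ ⁻≋) zᵍ≈k W.refl)
                                 (Listing.complete listing-H (⟨⟩-from _ zᵍ∈H))))
      ... | e , e∈H₂ , s≐e = ⟨⟩-to z (Gen-resp XG (W.trans (W.sym (⟦⟧-cong s≐e)) (W.sym (represented z≈s)))
                                                   (All.lookup (Listing.sound listing-H₂) e∈H₂))
      from : In⟨h₂⟩ z → InH z × InH ((g X.∙ z) X.∙ (g X.⁻¹))
      from z∈⟨h₂⟩ with represent listing-H₂ g-centralises-⟨h₂⟩ (⟨⟩-from z z∈⟨h₂⟩)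
      ... | e , gegᵍ≐e , z≈e = ⟨⟩-to z (⟨h₂⟩⊆H (⟨⟩-from z z∈⟨h₂⟩)) ,
        ⟨⟩-to _ (⟨h₂⟩⊆H (Gen-resp XG (W.sym zᵍ≈z) (⟨⟩-from z z∈⟨h₂⟩)))
        where
        zᵍ≈z : (g X.∙ z) X.∙ g X.⁻¹ W.≈ z
        zᵍ≈z = W.trans (represented (g≈gˢ ⊗≋ z≈e ⊗≋ g≈gˢ ⁻≋)) (W.trans (⟦⟧-cong gegᵍ≐e) (W.sym (represented z≈e)))

  module CosetGraph where

    open import Level using (_⊔_)
    open import Data.Fin.Patterns using (0F; 1F; 2F; 3F; 4F; 5F; 6F)
    open import Data.List using (List; []; _∷_)
    open import Data.List.Relation.Unary.All as All using (All; all?)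
    open import Data.List.Relation.Unary.Any as Any using (Any; here; there; any?)
    open import Data.List.Membership.Propositional using (find)
    open import Data.Nat using (_%_)
    open import Data.Nat.Properties using (_≟_)
    open import Data.Product using (Σ; _×_; _,_; proj₂)
    open import Data.Sum using (_⊎_; inj₁; inj₂)
    open import Data.Vec using ([]; _∷_)
    open import Data.Empty using (⊥-elim)
    open import Relation.Nullary using (¬_)
    open import Relation.Nullary.Decidable using (from-yes; ¬?; _⊎-dec_)
    open import Relation.Binary.PropositionalEquality as ≡ using (_≡_)
    import Relation.Binary.Reasoning.Setoid as SetoidReasoning
    open import Defs using (module Wreath; Even; inversions)
    open GroupSolver using (var; _⊙_; inv; one)
    open Generated
    open WreathGroup using (XG; wrap; unwrap; InX-∙; InX-⁻¹; InX-resp; ∙-congˡ; ∙-congʳ)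
    open Symbolic
    open Semantics
    open Subgroups

    open Wreath P μ lam
    open SetoidReasoning W.setoid
    module GS = GroupSolver.Solve XG

    ⇒InH : ∀ x → x ∈⟨ IsH ⟩ → InH x
    ⇒InH = ⟨⟩-to

    InH⇒ : ∀ x → InH x → x ∈⟨ IsH ⟩
    InH⇒ = ⟨⟩-from

    InH-resp : ∀ {x y} → x W.≈ y → x ∈⟨ IsH ⟩ → y ∈⟨ IsH ⟩
    InH-resp = Gen-resp XG

    ε∈H : X.ε ∈⟨ IsH ⟩
    ε∈H = Gen-ε XG

    g⁻¹≈g : g X.⁻¹ W.≈ g
    g⁻¹≈g = W.trans (represented (g≈gˢ ⁻≋)) (W.trans (⟦⟧-cong (from-yes (gˢ ⁻ˢ ≐? gˢ))) (W.sym (represented g≈gˢ)))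

    opaque
      H⊆X : All (λ s → Even (proj₂ s)) Hˢ
      H⊆X = from-yes (all? (λ s → inversions (proj₂ s) % 2 ≟ 0) Hˢ)

    InX-H : ∀ {x} → x ∈⟨ IsH ⟩ → InX x
    InX-H x∈H with represent listing-H H⊆X x∈H
    ... | s , s-even , x≈s = InX-resp (W.sym (represented x≈s)) s-even

    Adj-sym : ∀ x y → Adj x y → Adj y x
    Adj-sym x y (a , b , a∈H , b∈H , yx⁻¹≈agb) =
      b X.⁻¹ , a X.⁻¹ , ⇒InH _ (Gen-⁻¹ XG (InH⇒ b b∈H)) , ⇒InH _ (Gen-⁻¹ XG (InH⇒ a a∈H)) , unwrap (begin
        x X.∙ y X.⁻¹                          ≈⟨ GS.solve (x ∷ y ∷ []) (var 0F ⊙ inv (var 1F))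
                                                    (inv (var 1F ⊙ inv (var 0F))) ≡.refl ⟩
        (y X.∙ x X.⁻¹) X.⁻¹                   ≈⟨ W.⁻¹-cong (wrap yx⁻¹≈agb) ⟩
        ((a X.∙ g) X.∙ b) X.⁻¹                ≈⟨ GS.solve (a ∷ g ∷ b ∷ []) (inv ((var 0F ⊙ var 1F) ⊙ var 2F))
                                                    ((inv (var 2F) ⊙ inv (var 1F)) ⊙ inv (var 0F)) ≡.refl ⟩
        (b X.⁻¹ X.∙ g X.⁻¹) X.∙ a X.⁻¹        ≈⟨ ∙-congʳ (a X.⁻¹) (∙-congˡ (b X.⁻¹) g⁻¹≈g) ⟩
        (b X.⁻¹ X.∙ g) X.∙ a X.⁻¹             ∎)

    HgH-represent : ∀ z → InHgH z → ∀ {p} {Q : Sym → Sym → Set p} →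
      All (λ s → All (Q s) Hˢ) Hˢ → Σ Sym λ s → Σ Sym λ t → Q s t × z ≈⟦ s ⊗ gˢ ⊗ t ⟧
    HgH-represent z (a , b , a∈H , b∈H , z≈agb) checked with represent listing-H checked (InH⇒ a a∈H)
    ... | s , s-ok , a≈s with represent listing-H s-ok (InH⇒ b b∈H)
    ... | t , st-ok , b≈t = s , t , st-ok ,
      represents (W.trans (wrap {z} {(a X.∙ g) X.∙ b} z≈agb) (represented (a≈s ⊗≋ g≈gˢ ⊗≋ b≈t)))

    opaque
      gˢ∉HgH : All (λ s → All (λ t → ¬ (s ⊗ gˢ ⊗ t ≈ᵖ idˢ)) Hˢ) Hˢ
      gˢ∉HgH = from-yes (all? (λ s → all? (λ t → ¬? (s ⊗ gˢ ⊗ t ≈ᵖ? idˢ)) Hˢ) Hˢ)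

    no-loops : ∀ x → ¬ Adj x x
    no-loops x x~x with HgH-represent (x X.∙ x X.⁻¹) x~x gˢ∉HgH
    ... | s , t , sgt≉id , xx⁻¹≈sgt = sgt≉id (≈ᵖ-of xx⁻¹≈sgt ε≈idˢ (W.inverseʳ x))

    neighbour : Elem → Sym → Elem
    neighbour x t = ⟦ gˢ ⊗ t ⟧ X.∙ x

    InX-neighbour : ∀ x t → Even (proj₂ (gˢ ⊗ t)) → InX x → InX (neighbour x t)
    InX-neighbour x t gt-even x∈X = InX-∙ {⟦ gˢ ⊗ t ⟧} {x} gt-even x∈X

    Adj-neighbour : ∀ x t → Any (t ≐_) H₁ˢ → Adj x (neighbour x t)
    Adj-neighbour x t t∈H₁ =
      X.ε , ⟦ t ⟧ , ⇒InH X.ε ε∈H , ⇒InH ⟦ t ⟧ (⟨h₁⟩⊆H (listed-member listing-H₁ t∈H₁)) , unwrap (begin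
        ⟦ gˢ ⊗ t ⟧ X.∙ x X.∙ x X.⁻¹     ≈⟨ GS.solve (⟦ gˢ ⊗ t ⟧ ∷ x ∷ []) ((var 0F ⊙ var 1F) ⊙ inv (var 1F))
                                                    (var 0F) ≡.refl ⟩
        ⟦ gˢ ⊗ t ⟧                      ≈⟨ represented (ε≈idˢ ⊗≋ g≈gˢ ⊗≋ ⟦⟧-represents t) ⟨
        X.ε X.∙ g X.∙ ⟦ t ⟧             ∎)

    neighbours-distinct : ∀ x s t → ¬ Any (λ k → (gˢ ⊗ t) ⊗ (gˢ ⊗ s) ⁻ˢ ≈ᵖ k) Hˢ →
                          ¬ SameV (neighbour x s) (neighbour x t)
    neighbours-distinct x s t not-in-H same = not-in-H (Any.map (λ q≈k → ≈ᵖ-of q≈q′ q≈k W.refl) (Listing.complete listing-H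
      (InH⇒ _ same)))
      where
      q≈q′ : neighbour x t X.∙ neighbour x s X.⁻¹ ≈⟦ (gˢ ⊗ t) ⊗ (gˢ ⊗ s) ⁻ˢ ⟧
      q≈q′ = represents (W.trans
        (GS.solve (⟦ gˢ ⊗ t ⟧ ∷ ⟦ gˢ ⊗ s ⟧ ∷ x ∷ []) ((var 0F ⊙ var 2F) ⊙ inv (var 1F ⊙ var 2F))
                  (var 0F ⊙ inv (var 1F)) ≡.refl)
        (represented (⟦⟧-represents (gˢ ⊗ t) ⊗≋ ⟦⟧-represents (gˢ ⊗ s) ⁻≋)))

    opaque
      HgH-covered : All (λ s → All (λ u → Any (λ t → Any ((gˢ ⊗ t) ⊗ (s ⊗ gˢ ⊗ u) ⁻ˢ ≐_) Hˢ) H₁ˢ) Hˢ) Hˢ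
      HgH-covered = from-yes (all? (λ s → all? (λ u → any? (λ t → any? ((gˢ ⊗ t) ⊗ (s ⊗ gˢ ⊗ u) ⁻ˢ ≐?_) Hˢ) H₁ˢ) Hˢ) Hˢ)

    neighbours-complete : ∀ x y → Adj x y → Any (λ t → SameV y (neighbour x t)) H₁ˢ
    neighbours-complete x y x~y with HgH-represent (y X.∙ x X.⁻¹) x~y HgH-covered
    ... | s , u , covered , yx⁻¹≈sgu = Any.map (λ {t} → same {t}) covered
      where
      same : ∀ {t} → Any ((gˢ ⊗ t) ⊗ (s ⊗ gˢ ⊗ u) ⁻ˢ ≐_) Hˢ → SameV y (neighbour x t)
      same {t} in-H = ⇒InH (neighbour x t X.∙ y X.⁻¹) (InH-resp (W.sym (begin
        neighbour x t X.∙ y X.⁻¹               ≈⟨ GS.solve (⟦ gˢ ⊗ t ⟧ ∷ x ∷ y ∷ []) ((var 0F ⊙ var 1F) ⊙ inv (var 2F))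
                                                     (var 0F ⊙ inv (var 2F ⊙ inv (var 1F))) ≡.refl ⟩
        ⟦ gˢ ⊗ t ⟧ X.∙ (y X.∙ x X.⁻¹) X.⁻¹     ≈⟨ represented (⟦⟧-represents (gˢ ⊗ t) ⊗≋ yx⁻¹≈sgu ⁻≋) ⟩
        ⟦ (gˢ ⊗ t) ⊗ (s ⊗ gˢ ⊗ u) ⁻ˢ ⟧         ∎)) (listed-member listing-H in-H))

    cubic : IsCubicGraph
    cubic = (λ x y _ _ → Adj-sym x y) , (λ x _ → no-loops x) , λ x x∈X →
      neighbour x t₁ , neighbour x t₂ , neighbour x t₃ ,
      (InX-neighbour x t₁ ≡.refl x∈X , InX-neighbour x t₂ ≡.refl x∈X , InX-neighbour x t₃ ≡.refl x∈X) ,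
      (Adj-neighbour x t₁ (from-yes (any? (t₁ ≐?_) H₁ˢ)) , Adj-neighbour x t₂ (from-yes (any? (t₂ ≐?_) H₁ˢ)) ,
       Adj-neighbour x t₃ (from-yes (any? (t₃ ≐?_) H₁ˢ))) ,
      (neighbours-distinct x t₁ t₂ (from-yes (¬? (any? ((gˢ ⊗ t₂) ⊗ (gˢ ⊗ t₁) ⁻ˢ ≈ᵖ?_) Hˢ))) ,
       neighbours-distinct x t₁ t₃ (from-yes (¬? (any? ((gˢ ⊗ t₃) ⊗ (gˢ ⊗ t₁) ⁻ˢ ≈ᵖ?_) Hˢ))) ,
       neighbours-distinct x t₂ t₃ (from-yes (¬? (any? ((gˢ ⊗ t₃) ⊗ (gˢ ⊗ t₂) ⁻ˢ ≈ᵖ?_) Hˢ)))) ,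
      λ y _ x~y → one-of {x} {y} (neighbours-complete x y x~y)
      where
      t₁ t₂ t₃ : Sym
      t₁ = idˢ
      t₂ = h₁ˢ
      t₃ = h₁ˢ ⊗ h₁ˢ
      one-of : ∀ {x y} → Any (λ t → SameV y (neighbour x t)) H₁ˢ →
               SameV y (neighbour x t₁) ⊎ SameV y (neighbour x t₂) ⊎ SameV y (neighbour x t₃)
      one-of (here same)                 = inj₁ same
      one-of (there (here same))         = inj₂ (inj₁ same)
      one-of (there (there (here same))) = inj₂ (inj₂ same)

    Cˢ : Sym
    Cˢ = gˢ ⊗ h₁ˢ ⊗ gˢ

    opaque
      gHg-cases : All (λ k → Any (gˢ ⊗ k ⊗ gˢ ≐_) Hˢ ⊎ Any (λ q → Any (λ e → gˢ ⊗ k ⊗ gˢ ≐ q ⊗ Cˢ ⊗ e) H₂ˢ) Hˢ)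
                      Hˢ
      gHg-cases = from-yes (all? (λ k → any? (gˢ ⊗ k ⊗ gˢ ≐?_) Hˢ ⊎-dec
                                        any? (λ q → any? (λ e → gˢ ⊗ k ⊗ gˢ ≐? q ⊗ Cˢ ⊗ e) H₂ˢ) Hˢ) Hˢ)

    ReachesBase : Elem → Elem → Elem → Set (c ⊔ ℓ)
    ReachesBase u v w = Σ Elem λ y → InX y × SameV (u X.∙ y) X.ε × SameV (v X.∙ y) g × SameV (w X.∙ y) ⟦ Cˢ ⟧

    -- With v u⁻¹ = a g b and w v⁻¹ = c g d, the condition w u⁻¹ ∉ H keeps g (d a) g out of H, and every
    -- other element of g H g lies in H (g h₁ g) ⟨h₂⟩; that decomposition yields the mapping element.
    2-arc-reaches-base : ∀ u v w → Is2Arc u v w → ReachesBase u v w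
    2-arc-reaches-base u v w
      ((u∈X , _ , _) , ((a , b , a∈H , b∈H , vu⁻¹≈agb) , (c , d , c∈H , d∈H , wv⁻¹≈cgd)) , (_ , _ , u≁w))
      with represent listing-H gHg-cases (Gen-∙ XG (InH⇒ d d∈H) (InH⇒ a a∈H))
    ... | k , inj₁ gkg∈H , da≈k = ⊥-elim (u≁w (⇒InH _ (InH-resp (W.sym wu⁻¹≈cDb)
      (Gen-∙ XG (Gen-∙ XG (InH⇒ c c∈H) (Gen-resp XG (W.sym (represented D≈gkg)) (listed-member listing-H gkg∈H))) (InH⇒ b b∈H)))))
      where
      D≈gkg = g≈gˢ ⊗≋ da≈k ⊗≋ g≈gˢ
      wu⁻¹≈cDb : w X.∙ u X.⁻¹ W.≈ (c X.∙ ((g X.∙ (d X.∙ a)) X.∙ g)) X.∙ b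
      wu⁻¹≈cDb = begin
        w X.∙ u X.⁻¹                                ≈⟨ GS.solve (u ∷ v ∷ w ∷ []) (var 2F ⊙ inv (var 0F))
                                                         ((var 2F ⊙ inv (var 1F)) ⊙ (var 1F ⊙ inv (var 0F))) ≡.refl ⟩
        (w X.∙ v X.⁻¹) X.∙ (v X.∙ u X.⁻¹)           ≈⟨ W.∙-cong (wrap {w X.∙ v X.⁻¹} {(c X.∙ g) X.∙ d} wv⁻¹≈cgd)
                                                                  (wrap {v X.∙ u X.⁻¹} {(a X.∙ g) X.∙ b} vu⁻¹≈agb) ⟩
        ((c X.∙ g) X.∙ d) X.∙ ((a X.∙ g) X.∙ b)     ≈⟨ GS.solve (a ∷ b ∷ c ∷ d ∷ g ∷ [])
                                                         (((var 2F ⊙ var 4F) ⊙ var 3F) ⊙ ((var 0F ⊙ var 4F) ⊙ var 1F))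
                                                         ((var 2F ⊙ ((var 4F ⊙ (var 3F ⊙ var 0F)) ⊙ var 4F)) ⊙ var 1F) ≡.refl ⟩
        (c X.∙ ((g X.∙ (d X.∙ a)) X.∙ g)) X.∙ b     ∎
    ... | k , inj₂ gkg∈HCH₂ , da≈k with find gkg∈HCH₂
    ... | q , q∈H , gkg∈qCH₂ with find gkg∈qCH₂
    ... | e , e∈H₂ , gkg≐qCe = y , y∈X , ⇒InH _ (InH-resp (W.sym uy) (Gen-∙ XG E∈H (InH⇒ b b∈H))) ,
      ⇒InH _ (InH-resp (W.sym vy) (Gen-∙ XG gEg⁻¹∈H (Gen-⁻¹ XG (InH⇒ a a∈H)))) ,
      ⇒InH _ (InH-resp (W.sym wy) (Gen-∙ XG (Gen-⁻¹ XG Q∈H) (Gen-⁻¹ XG (InH⇒ c c∈H))))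
      where
      Q E C : Elem
      Q = ⟦ q ⟧
      E = ⟦ e ⟧
      C = ⟦ Cˢ ⟧
      Q∈H : Q ∈⟨ IsH ⟩
      Q∈H = All.lookup (Listing.sound listing-H) q∈H
      E∈H : E ∈⟨ IsH ⟩
      E∈H = ⟨h₂⟩⊆H (All.lookup (Listing.sound listing-H₂) e∈H₂)
      gEg⁻¹∈H : g X.∙ E X.∙ g X.⁻¹ ∈⟨ IsH ⟩
      gEg⁻¹∈H = Gen-resp XG (W.sym (W.trans (represented (g≈gˢ ⊗≋ ⟦⟧-represents e ⊗≋ g≈gˢ ⁻≋))
                                            (⟦⟧-cong (All.lookup g-centralises-⟨h₂⟩ e∈H₂))))
                             E∈H
      y : Elem
      y = (u X.⁻¹ X.∙ b X.⁻¹) X.∙ E X.⁻¹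
      y∈X : InX y
      y∈X = InX-∙ {u X.⁻¹ X.∙ b X.⁻¹} {E X.⁻¹}
                  (InX-∙ {u X.⁻¹} {b X.⁻¹} (InX-⁻¹ {u} u∈X) (InX-⁻¹ {b} (InX-H (InH⇒ b b∈H))))
                  (InX-⁻¹ {E} (InX-H E∈H))
      vu⁻¹ : v X.∙ u X.⁻¹ W.≈ (a X.∙ g) X.∙ b
      vu⁻¹ = wrap {v X.∙ u X.⁻¹} {(a X.∙ g) X.∙ b} vu⁻¹≈agb
      wv⁻¹ : w X.∙ v X.⁻¹ W.≈ (c X.∙ g) X.∙ d
      wv⁻¹ = wrap {w X.∙ v X.⁻¹} {(c X.∙ g) X.∙ d} wv⁻¹≈cgd
      D≈QCE : (g X.∙ (d X.∙ a)) X.∙ g W.≈ (Q X.∙ C) X.∙ E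
      D≈QCE = W.trans (represented (g≈gˢ ⊗≋ da≈k ⊗≋ g≈gˢ))
                      (W.trans (⟦⟧-cong gkg≐qCe) (W.sym (represented (⟦⟧-represents q ⊗≋ ⟦⟧-represents Cˢ ⊗≋ ⟦⟧-represents e))))
      uy : X.ε X.∙ (u X.∙ y) X.⁻¹ W.≈ E X.∙ b
      uy = GS.solve (u ∷ b ∷ E ∷ []) (one ⊙ inv (var 0F ⊙ ((inv (var 0F) ⊙ inv (var 1F)) ⊙ inv (var 2F))))
                                     (var 2F ⊙ var 1F) ≡.refl
      vy : g X.∙ (v X.∙ y) X.⁻¹ W.≈ (g X.∙ E X.∙ g X.⁻¹) X.∙ a X.⁻¹
      vy = begin
        g X.∙ (v X.∙ y) X.⁻¹                              ≈⟨ GS.solve (u ∷ v ∷ b ∷ E ∷ g ∷ [])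
                                                               (var 4F ⊙ inv (var 1F ⊙ ((inv (var 0F) ⊙ inv (var 2F)) ⊙ inv (var 3F))))
                                                               (((var 4F ⊙ var 3F) ⊙ var 2F) ⊙ inv (var 1F ⊙ inv (var 0F))) ≡.refl ⟩
        ((g X.∙ E) X.∙ b) X.∙ (v X.∙ u X.⁻¹) X.⁻¹         ≈⟨ ∙-congˡ ((g X.∙ E) X.∙ b) (W.⁻¹-cong vu⁻¹) ⟩
        ((g X.∙ E) X.∙ b) X.∙ ((a X.∙ g) X.∙ b) X.⁻¹      ≈⟨ GS.solve (a ∷ b ∷ E ∷ g ∷ [])
                                                               (((var 3F ⊙ var 2F) ⊙ var 1F) ⊙ inv ((var 0F ⊙ var 3F) ⊙ var 1F))
                                                               (((var 3F ⊙ var 2F) ⊙ inv (var 3F)) ⊙ inv (var 0F)) ≡.refl ⟩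
        (g X.∙ E X.∙ g X.⁻¹) X.∙ a X.⁻¹                   ∎
      wy : C X.∙ (w X.∙ y) X.⁻¹ W.≈ Q X.⁻¹ X.∙ c X.⁻¹
      wy = begin
        C X.∙ (w X.∙ y) X.⁻¹                                          ≈⟨ GS.solve (u ∷ v ∷ w ∷ b ∷ E ∷ C ∷ [])
            (var 5F ⊙ inv (var 2F ⊙ ((inv (var 0F) ⊙ inv (var 3F)) ⊙ inv (var 4F))))
            (((var 5F ⊙ var 4F) ⊙ var 3F) ⊙ (inv (var 1F ⊙ inv (var 0F)) ⊙ inv (var 2F ⊙ inv (var 1F)))) ≡.refl ⟩
        ((C X.∙ E) X.∙ b) X.∙ ((v X.∙ u X.⁻¹) X.⁻¹ X.∙ (w X.∙ v X.⁻¹) X.⁻¹)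
          ≈⟨ ∙-congˡ ((C X.∙ E) X.∙ b) (W.∙-cong (W.⁻¹-cong vu⁻¹) (W.⁻¹-cong wv⁻¹)) ⟩
        ((C X.∙ E) X.∙ b) X.∙ (((a X.∙ g) X.∙ b) X.⁻¹ X.∙ ((c X.∙ g) X.∙ d) X.⁻¹)
                                                                      ≈⟨ GS.solve (a ∷ b ∷ c ∷ d ∷ g ∷ E ∷ C ∷ [])
            (((var 6F ⊙ var 5F) ⊙ var 1F) ⊙ (inv ((var 0F ⊙ var 4F) ⊙ var 1F) ⊙ inv ((var 2F ⊙ var 4F) ⊙ var 3F)))
            ((var 6F ⊙ var 5F) ⊙ (inv ((var 4F ⊙ (var 3F ⊙ var 0F)) ⊙ var 4F) ⊙ inv (var 2F))) ≡.refl ⟩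
        (C X.∙ E) X.∙ (((g X.∙ (d X.∙ a)) X.∙ g) X.⁻¹ X.∙ c X.⁻¹)
          ≈⟨ ∙-congˡ (C X.∙ E) (∙-congʳ (c X.⁻¹) (W.⁻¹-cong D≈QCE)) ⟩
        (C X.∙ E) X.∙ (((Q X.∙ C) X.∙ E) X.⁻¹ X.∙ c X.⁻¹)             ≈⟨ GS.solve (c ∷ E ∷ Q ∷ C ∷ [])
            ((var 3F ⊙ var 1F) ⊙ (inv ((var 2F ⊙ var 3F) ⊙ var 1F) ⊙ inv (var 0F)))
            (inv (var 2F) ⊙ inv (var 0F)) ≡.refl ⟩
        Q X.⁻¹ X.∙ c X.⁻¹                                             ∎

    two-arc-transitive : Is2ArcTransitive
    two-arc-transitive u v w u′ v′ w′ arc arc′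
      with 2-arc-reaches-base u v w arc | 2-arc-reaches-base u′ v′ w′ arc′
    ... | y , y∈X , u~ , v~ , w~ | y′ , y′∈X , u′~ , v′~ , w′~ =
      y X.∙ y′ X.⁻¹ , InX-∙ {y} {y′ X.⁻¹} y∈X (InX-⁻¹ {y′} y′∈X) ,
      transfer u u′ X.ε u~ u′~ , transfer v v′ g v~ v′~ , transfer w w′ ⟦ Cˢ ⟧ w~ w′~
      where
      transfer : ∀ p p′ b → SameV (p X.∙ y) b → SameV (p′ X.∙ y′) b → SameV (p X.∙ (y X.∙ y′ X.⁻¹)) p′
      transfer p p′ b p~b p′~b = ⇒InH _ (InH-resp
        (GS.solve (p ∷ p′ ∷ y ∷ y′ ∷ b ∷ []) (inv (var 4F ⊙ inv (var 1F ⊙ var 3F)) ⊙ (var 4F ⊙ inv (var 0F ⊙ var 2F)))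
                  (var 1F ⊙ inv (var 0F ⊙ (var 2F ⊙ inv (var 3F)))) ≡.refl)
        (Gen-∙ XG (Gen-⁻¹ XG (InH⇒ (b X.∙ (p′ X.∙ y′) X.⁻¹) p′~b)) (InH⇒ (b X.∙ (p X.∙ y) X.⁻¹) p~b)))

  module NormalQuotient where

    open import Data.Fin using (Fin; _<_; _<?_; _≟_)
    import Data.Fin.Properties as Fin
    open import Data.Fin.Patterns using (0F; 1F; 2F; 3F; 4F)
    open import Data.Fin.Permutation using (Permutation′; _⟨$⟩ʳ_; inverseʳ)
      renaming (_≈_ to _≈ₚ_)
    open import Data.List using ([]; _∷_)
    open import Data.List.Relation.Unary.All as All using (All; all?)
    open import Data.List.Relation.Unary.Any as Any using (Any; any?)
    open import Data.List.Membership.Propositional using (_∈_; find)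
    open import Data.Nat using (_%_)
    import Data.Nat.Properties as ℕ
    open import Data.Product using (Σ; _×_; _,_; proj₁; proj₂)
    open import Data.Product.Properties using (≡-dec)
    open import Data.Sum using (_⊎_; inj₁; inj₂)
    open import Data.Vec using ([]; _∷_)
    open import Function using (_∘_)
    open import Function.Bundles using (Equivalence)
    open import Relation.Nullary using (¬_; Dec)
    open import Relation.Nullary.Decidable using (from-yes; ¬?; _×-dec_; _⊎-dec_; _→-dec_)
    open import Relation.Binary.PropositionalEquality as ≡ using (_≡_; _≢_)
    import Relation.Binary.Reasoning.Setoid as SetoidReasoning
    open import Defs using (module Wreath; module Quot; Even; inversions; PetV; PetEq; PetAdj)
    open GroupSolver using (var; _⊙_; inv; one)
    open Generated
    open Parity using (Even-resp)
    open Permutations using (perms; ∀-perms; permute-injective; flip-cong)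
    open WreathGroup using (unwrap; InX-∙; InX-⁻¹)
    open Symbolic
    open Semantics
    open Subgroups
    open CosetGraph
    open Petersen

    open Wreath P μ lam

    perm : Elem → Permutation′ 5
    perm = proj₂

    -- Equality of the S₅-components; a record so that implicit arguments can be inferred.
    infix 4 _∼_
    record _∼_ (x y : Elem) : Set where
      constructor ∼-intro
      field ∼-perm : perm x ≈ₚ perm y
    open _∼_

    ≋⇒∼ : ∀ {x y} → x W.≈ y → x ∼ y
    ≋⇒∼ x≈y = ∼-intro (proj₂ (unwrap x≈y))

    ∼-trans : ∀ {x y z} → x ∼ y → y ∼ z → x ∼ z
    ∼-trans (∼-intro x∼y) (∼-intro y∼z) = ∼-intro λ i → ≡.trans (x∼y i) (y∼z i)

    ∼-sym : ∀ {x y} → x ∼ y → y ∼ x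
    ∼-sym (∼-intro x∼y) = ∼-intro λ i → ≡.sym (x∼y i)

    ∼-∙ : ∀ {x x′ y y′} → x ∼ x′ → y ∼ y′ → x X.∙ y ∼ x′ X.∙ y′
    ∼-∙ {y = y} (∼-intro x∼x′) (∼-intro y∼y′) =
      ∼-intro λ i → ≡.trans (≡.cong (perm y ⟨$⟩ʳ_) (x∼x′ i)) (y∼y′ _)

    ∼-⁻¹ : ∀ {x y} → x ∼ y → x X.⁻¹ ∼ y X.⁻¹
    ∼-⁻¹ {x} {y} (∼-intro x∼y) = ∼-intro (flip-cong {π = perm x} {perm y} x∼y)

    ∼-refl : ∀ {x} → x ∼ x
    ∼-refl = ∼-intro λ _ → ≡.refl

    Stabilises34 MovesOff34 : Permutation′ 5 → Set
    Stabilises34 ρ = (ρ ⟨$⟩ʳ 3F ≡ 3F × ρ ⟨$⟩ʳ 4F ≡ 4F) ⊎ (ρ ⟨$⟩ʳ 3F ≡ 4F × ρ ⟨$⟩ʳ 4F ≡ 3F)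
    MovesOff34 ρ = ρ ⟨$⟩ʳ 3F ≢ 3F × ρ ⟨$⟩ʳ 3F ≢ 4F × ρ ⟨$⟩ʳ 4F ≢ 3F × ρ ⟨$⟩ʳ 4F ≢ 4F

    stabilises? : ∀ (ρ : Permutation′ 5) → Dec (Stabilises34 ρ)
    stabilises? ρ = (ρ ⟨$⟩ʳ 3F ≟ 3F ×-dec ρ ⟨$⟩ʳ 4F ≟ 4F) ⊎-dec (ρ ⟨$⟩ʳ 3F ≟ 4F ×-dec ρ ⟨$⟩ʳ 4F ≟ 3F)

    movesOff? : ∀ (ρ : Permutation′ 5) → Dec (MovesOff34 ρ)
    movesOff? ρ =
      ¬? (ρ ⟨$⟩ʳ 3F ≟ 3F) ×-dec ¬? (ρ ⟨$⟩ʳ 3F ≟ 4F) ×-dec ¬? (ρ ⟨$⟩ʳ 4F ≟ 3F) ×-dec ¬? (ρ ⟨$⟩ʳ 4F ≟ 4F)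

    even? : ∀ (ρ : Permutation′ 5) → Dec (Even ρ)
    even? ρ = inversions ρ % 2 ℕ.≟ 0

    module _ (π ρ : Permutation′ 5) where
      private
        π[_] = π ⟨$⟩ʳ_
        inj = permute-injective π

      stabilises⇒sameSet : Stabilises34 ρ → SameSet π[ 3F ] π[ 4F ] π[ ρ ⟨$⟩ʳ 3F ] π[ ρ ⟨$⟩ʳ 4F ]
      stabilises⇒sameSet (inj₁ (ρ3 , ρ4)) = inj₁ (≡.cong π[_] (≡.sym ρ3) , ≡.cong π[_] (≡.sym ρ4))
      stabilises⇒sameSet (inj₂ (ρ3 , ρ4)) = inj₂ (≡.cong π[_] (≡.sym ρ4) , ≡.cong π[_] (≡.sym ρ3))

      sameSet⇒stabilises : SameSet π[ 3F ] π[ 4F ] π[ ρ ⟨$⟩ʳ 3F ] π[ ρ ⟨$⟩ʳ 4F ] → Stabilises34 ρ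
      sameSet⇒stabilises (inj₁ (e3 , e4)) = inj₁ (≡.sym (inj e3) , ≡.sym (inj e4))
      sameSet⇒stabilises (inj₂ (e3 , e4)) = inj₂ (≡.sym (inj e4) , ≡.sym (inj e3))

      movesOff⇒disjoint : MovesOff34 ρ → Disjoint π[ 3F ] π[ 4F ] π[ ρ ⟨$⟩ʳ 3F ] π[ ρ ⟨$⟩ʳ 4F ]
      movesOff⇒disjoint (ρ3≢3 , ρ3≢4 , ρ4≢3 , ρ4≢4) =
        (ρ3≢3 ∘ ≡.sym ∘ inj) , (ρ4≢3 ∘ ≡.sym ∘ inj) , (ρ3≢4 ∘ ≡.sym ∘ inj) , (ρ4≢4 ∘ ≡.sym ∘ inj)

      disjoint⇒movesOff : Disjoint π[ 3F ] π[ 4F ] π[ ρ ⟨$⟩ʳ 3F ] π[ ρ ⟨$⟩ʳ 4F ] → MovesOff34 ρ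
      disjoint⇒movesOff (d33 , d34 , d43 , d44) =
        (d33 ∘ ≡.sym ∘ ≡.cong π[_]) , (d43 ∘ ≡.sym ∘ ≡.cong π[_]) ,
        (d34 ∘ ≡.sym ∘ ≡.cong π[_]) , (d44 ∘ ≡.sym ∘ ≡.cong π[_])

    stabilises-resp : ∀ {π σ} → π ≈ₚ σ → Stabilises34 σ → Stabilises34 π
    stabilises-resp π≈σ (inj₁ (σ3 , σ4)) = inj₁ (≡.trans (π≈σ 3F) σ3 , ≡.trans (π≈σ 4F) σ4)
    stabilises-resp π≈σ (inj₂ (σ3 , σ4)) = inj₂ (≡.trans (π≈σ 3F) σ3 , ≡.trans (π≈σ 4F) σ4)

    movesOff-resp : ∀ {π σ} → π ≈ₚ σ → MovesOff34 σ → MovesOff34 π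
    movesOff-resp π≈σ (σ3≢3 , σ3≢4 , σ4≢3 , σ4≢4) =
      (σ3≢3 ∘ ≡.trans (≡.sym (π≈σ 3F))) , (σ3≢4 ∘ ≡.trans (≡.sym (π≈σ 3F))) ,
      (σ4≢3 ∘ ≡.trans (≡.sym (π≈σ 4F))) , (σ4≢4 ∘ ≡.trans (≡.sym (π≈σ 4F)))

    opaque
      H-stabilises34 : All (λ s → Stabilises34 (proj₂ s)) Hˢ
      H-stabilises34 = from-yes (all? (λ s → stabilises? (proj₂ s)) Hˢ)

      HgH-movesOff34 : All (λ s → All (λ t → MovesOff34 (proj₂ (s ⊗ gˢ ⊗ t))) Hˢ) Hˢ
      HgH-movesOff34 = from-yes (all? (λ s → all? (λ t → movesOff? (proj₂ (s ⊗ gˢ ⊗ t))) Hˢ) Hˢ)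

      A₅-stabiliser : ∀ ρ → Even ρ → Stabilises34 ρ → Any (λ s → ρ ≈ₚ proj₂ s) Hˢ
      A₅-stabiliser = ∀-perms
        (λ {π} {σ} π≈σ σ-ok π-even π-stab → Any.map (λ σ≈s i → ≡.trans (π≈σ i) (σ≈s i))
          (σ-ok (Even-resp {π = π} {σ} π≈σ π-even) (stabilises-resp {σ} {π} (λ i → ≡.sym (π≈σ i)) π-stab)))
        (from-yes (all? (λ ρ → even? ρ →-dec stabilises? ρ →-dec any? (λ s → ρ Permutations.≈ₚ? proj₂ s) Hˢ) (perms 5)))

      A₅-movesOff : ∀ ρ → Even ρ → MovesOff34 ρ → Any (λ s → Any (λ t → ρ ≈ₚ proj₂ (s ⊗ gˢ ⊗ t)) Hˢ) Hˢ
      A₅-movesOff = ∀-perms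
        (λ {π} {σ} π≈σ σ-ok π-even π-off → Any.map (Any.map (λ σ≈sgt i → ≡.trans (π≈σ i) (σ≈sgt i)))
          (σ-ok (Even-resp {π = π} {σ} π≈σ π-even) (movesOff-resp {σ} {π} (λ i → ≡.sym (π≈σ i)) π-off)))
        (from-yes (all? (λ ρ → even? ρ →-dec movesOff? ρ →-dec
                               any? (λ s → any? (λ t → ρ Permutations.≈ₚ? proj₂ (s ⊗ gˢ ⊗ t)) Hˢ) Hˢ) (perms 5)))

      every-pair-realised : ∀ a b → a < b →
                            Any (λ ρ → proj₁ (pair (ρ ⟨$⟩ʳ 3F) (ρ ⟨$⟩ʳ 4F)) ≡ (a , b) × Even ρ) (perms 5)
      every-pair-realised = from-yes (Fin.all? λ a → Fin.all? λ b → (a <? b) →-dec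
        any? (λ ρ → ≡-dec _≟_ _≟_ (proj₁ (pair (ρ ⟨$⟩ʳ 3F) (ρ ⟨$⟩ʳ 4F))) (a , b) ×-dec even? ρ) (perms 5))

    φ : Elem → PetV
    φ x = pair (perm x ⟨$⟩ʳ 3F) (perm x ⟨$⟩ʳ 4F)

    images-distinct : ∀ x → perm x ⟨$⟩ʳ 3F ≢ perm x ⟨$⟩ʳ 4F
    images-distinct x = (λ ()) ∘ permute-injective (perm x)

    factor : ∀ x y i → perm y ⟨$⟩ʳ i ≡ perm x ⟨$⟩ʳ (perm (y X.∙ x X.⁻¹) ⟨$⟩ʳ i)
    factor x y i = ≡.sym (inverseʳ (perm x))

    orbit-lemma : ∀ x y h → h ∈⟨ IsH ⟩ → y X.∙ x X.⁻¹ ∼ h → SameOrbit x y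
    orbit-lemma x y h h∈H yx⁻¹∼h = n , ∼-perm n∼ε ,
      ⇒InH _ (InH-resp (GS.solve (x ∷ y ∷ h ∷ []) (var 2F)
                                  (var 1F ⊙ inv (var 0F ⊙ (inv (var 0F) ⊙ (inv (var 2F) ⊙ var 1F)))) ≡.refl) h∈H)
      where
      n = x X.⁻¹ X.∙ (h X.⁻¹ X.∙ y)
      n∼ε : n ∼ X.ε
      n∼ε = ∼-trans (∼-∙ (∼-refl {x X.⁻¹}) (∼-∙ (∼-⁻¹ (∼-sym yx⁻¹∼h)) (∼-refl {y})))
                    (≋⇒∼ (GS.solve (x ∷ y ∷ []) (inv (var 0F) ⊙ (inv (var 1F ⊙ inv (var 0F)) ⊙ var 1F)) one ≡.refl))

    same-orbit⇒same-vertex : ∀ x y → SameOrbit x y → PetEq (φ x) (φ y)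
    same-orbit⇒same-vertex x y (n , n∈N , h∈H) with represent listing-H H-stabilises34 (InH⇒ (y X.∙ (x X.∙ n) X.⁻¹) h∈H)
    ... | s , s-stabilises , h≈s = Equivalence.from (pair-sameSet _ _ _ _ (images-distinct x) (images-distinct y))
      (≡.subst₂ (SameSet _ _) (≡.sym (y-via 3F)) (≡.sym (y-via 4F)) (stabilises⇒sameSet (perm x) (proj₂ s) s-stabilises))
      where
      h = y X.∙ (x X.∙ n) X.⁻¹
      y≈hxn : y W.≈ h X.∙ (x X.∙ n)
      y≈hxn = GS.solve (x X.∙ n ∷ y ∷ []) (var 1F) ((var 1F ⊙ inv (var 0F)) ⊙ var 0F) ≡.refl
      y-via : ∀ i → perm y ⟨$⟩ʳ i ≡ perm x ⟨$⟩ʳ (proj₂ s ⟨$⟩ʳ i)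
      y-via i = ≡.trans (∼-perm (≋⇒∼ y≈hxn) i)
                        (≡.trans (n∈N _) (≡.cong (perm x ⟨$⟩ʳ_) (∼-perm (≋⇒∼ (represented h≈s)) i)))

    same-vertex⇒same-orbit : ∀ x y → InX x → InX y → PetEq (φ x) (φ y) → SameOrbit x y
    same-vertex⇒same-orbit x y x∈X y∈X φx≡φy =
      let s , s∈H , ρ≈s = find (A₅-stabiliser ρ ρ-even ρ-stabilises)
      in orbit-lemma x y ⟦ s ⟧ (All.lookup (Listing.sound listing-H) s∈H) (∼-intro ρ≈s)
      where
      ρ : Permutation′ 5
      ρ = perm (y X.∙ x X.⁻¹)
      ρ-even : Even ρ
      ρ-even = InX-∙ {y} {x X.⁻¹} y∈X (InX-⁻¹ {x} x∈X)

      ρ-stabilises : Stabilises34 ρ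
      ρ-stabilises = sameSet⇒stabilises (perm x) ρ
        (≡.subst₂ (SameSet _ _) (factor x y 3F) (factor x y 4F)
          (Equivalence.to (pair-sameSet _ _ _ _ (images-distinct x) (images-distinct y)) φx≡φy))

    every-vertex-reached : ∀ p → Σ Elem λ x → InX x × PetEq (φ x) p
    every-vertex-reached ((a , b) , a<b) =
      let ρ , _ , φρ≡ab , ρ-even = find (every-pair-realised a b a<b)
      in ((λ _ → Group.ε P) , ρ) , ρ-even , φρ≡ab

    orbit-adjacent⇒adjacent : ∀ x y → OrbitAdj x y → PetAdj (φ x) (φ y)
    orbit-adjacent⇒adjacent x y (x′ , y′ , _ , _ , x~x′ , y~y′ , x′~y′) =
      PetAdj-resp {φ x} {φ x′} {φ y} {φ y′} (same-orbit⇒same-vertex x x′ x~x′) (same-orbit⇒same-vertex y y′ y~y′)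
        (Equivalence.from (pair-disjoint _ _ _ _ (images-distinct x′) (images-distinct y′))
          (≡.subst₂ (Disjoint _ _) (≡.sym (y′-via 3F)) (≡.sym (y′-via 4F))
                    (movesOff⇒disjoint (perm x′) (proj₂ (s ⊗ gˢ ⊗ t)) sgt-movesOff)))
      where
      represented-sgt = HgH-represent (y′ X.∙ x′ X.⁻¹) x′~y′ HgH-movesOff34
      s = proj₁ represented-sgt
      t = proj₁ (proj₂ represented-sgt)
      sgt-movesOff : MovesOff34 (proj₂ (s ⊗ gˢ ⊗ t))
      sgt-movesOff = proj₁ (proj₂ (proj₂ represented-sgt))
      y′-via : ∀ i → perm y′ ⟨$⟩ʳ i ≡ perm x′ ⟨$⟩ʳ (proj₂ (s ⊗ gˢ ⊗ t) ⟨$⟩ʳ i)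
      y′-via i = ≡.trans (factor x′ y′ i)
        (≡.cong (perm x′ ⟨$⟩ʳ_) (∼-perm (≋⇒∼ (represented (proj₂ (proj₂ (proj₂ represented-sgt))))) i))

    adjacent⇒orbit-adjacent : ∀ x y → InX x → InX y → PetAdj (φ x) (φ y) → OrbitAdj x y
    adjacent⇒orbit-adjacent x y x∈X y∈X φx~φy =
      let s , s∈H , sgt∈ = find (A₅-movesOff ρ ρ-even ρ-movesOff)
          t , t∈H , ρ≈sgt = find sgt∈
      in join s t s∈H t∈H ρ≈sgt
      where
      ρ : Permutation′ 5
      ρ = perm (y X.∙ x X.⁻¹)
      ρ-even : Even ρ
      ρ-even = InX-∙ {y} {x X.⁻¹} y∈X (InX-⁻¹ {x} x∈X)
      ρ-movesOff : MovesOff34 ρ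
      ρ-movesOff = disjoint⇒movesOff (perm x) ρ
        (≡.subst₂ (Disjoint _ _) (factor x y 3F) (factor x y 4F)
          (Equivalence.to (pair-disjoint _ _ _ _ (images-distinct x) (images-distinct y)) φx~φy))
      join : ∀ s t → s ∈ Hˢ → t ∈ Hˢ → ρ ≈ₚ proj₂ (s ⊗ gˢ ⊗ t) → OrbitAdj x y
      join s t s∈H t∈H ρ≈sgt =
        x , y′ , x∈X , y′∈X , orbit-lemma x x X.ε ε∈H (≋⇒∼ (W.inverseʳ x)) , orbit-lemma y y′ X.ε ε∈H y′y⁻¹∼ε ,
        (⟦ s ⟧ , ⟦ t ⟧ ,
         ⇒InH ⟦ s ⟧ (All.lookup (Listing.sound listing-H) s∈H) , ⇒InH ⟦ t ⟧ (All.lookup (Listing.sound listing-H) t∈H) ,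
         unwrap (W.trans (GS.solve (S ∷ x ∷ []) ((var 0F ⊙ var 1F) ⊙ inv (var 1F)) (var 0F) ≡.refl)
                         (W.sym (represented (⟦⟧-represents s ⊗≋ g≈gˢ ⊗≋ ⟦⟧-represents t)))))
        where
        S = ⟦ s ⊗ gˢ ⊗ t ⟧
        y′ = S X.∙ x
        y′∈X : InX y′
        y′∈X = InX-∙ {S} {x} (Even-resp {π = ρ} {perm S} ρ≈sgt ρ-even) x∈X
        y′y⁻¹∼ε : y′ X.∙ y X.⁻¹ ∼ X.ε
        y′y⁻¹∼ε = ∼-trans (∼-∙ (∼-∙ (∼-sym (∼-intro {y X.∙ x X.⁻¹} {S} ρ≈sgt)) (∼-refl {x})) (∼-refl {y X.⁻¹}))
          (≋⇒∼ (GS.solve (x ∷ y ∷ []) (((var 1F ⊙ inv (var 0F)) ⊙ var 0F) ⊙ inv (var 1F)) one ≡.refl))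

    quotient-is-Petersen : Quot.QuotientIsPetersen P μ lam
    quotient-is-Petersen = φ , (λ x y _ _ → same-orbit⇒same-vertex x y) , same-vertex⇒same-orbit , every-vertex-reached ,
      λ x y x∈X y∈X → orbit-adjacent⇒adjacent x y , adjacent⇒orbit-adjacent x y x∈X y∈X

mainTheorem4 : ∀ {c ℓ} (P : Group c ℓ) (μ lam : Group.Carrier P) →
    RG.Finite (Group.rawGroup P) →
    RG.Perfect (Group.rawGroup P) →
    (∀ x → RG.Gen (Group.rawGroup P) (λ y → Group._≈_ P y μ ⊎ Group._≈_ P y lam) x) →
    RG.HasOrder (Group.rawGroup P) μ 2 →
    RG.HasOrder (Group.rawGroup P) lam 3 →
    let open Wreath P μ lam in
    -- (1) H = ⟨h₁⟩:⟨h₂⟩ ≅ S₃ and |g| = 2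
    ( (∀ a z → InH a → In⟨h₁⟩ z → In⟨h₁⟩ ((a X.⁻¹ X.∙ z) X.∙ a))
    × (∀ z → In⟨h₁⟩ z → In⟨h₂⟩ z → z X.≈ X.ε)
    × (∀ z → InH z → ∃₂ λ a b → In⟨h₁⟩ a × In⟨h₂⟩ b × (z X.≈ (a X.∙ b)))
    × XIsoTo InH (SymRaw 3)
    × XHasOrder g 2 )
    -- (2) H ∩ H^g = ⟨h₂⟩ ≅ S₂
    × ( (∀ z → (InH z × InH ((g X.∙ z) X.∙ (g X.⁻¹))) ⇔ In⟨h₂⟩ z)
      × XIsoTo In⟨h₂⟩ (SymRaw 2) )
    -- (3) Γ is an (X,2)-arc-transitive cubic graph
    × ( IsCubicGraph × Is2ArcTransitive )
    -- (4) Γ_N ≅ Petersen graph, N = P⁵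
    × Quot.QuotientIsPetersen P μ lam
mainTheorem4 P μ lam _ _ _ (μ²≈ε , _) (λ³≈ε , _) =
  (⟨h₁⟩-normal , ⟨h₁⟩∩⟨h₂⟩-trivial , H≡⟨h₁⟩⟨h₂⟩ , H≅S₃ , g-order-2) ,
  (H∩Hᵍ≡⟨h₂⟩ , ⟨h₂⟩≅S₂) ,
  (cubic , two-arc-transitive) ,
  quotient-is-Petersen
  where
  open Group P
  μ² : μ ∙ μ ≈ ε
  μ² = trans (∙-congˡ (sym (identityʳ μ))) μ²≈ε
  λ³ : lam ∙ (lam ∙ lam) ≈ ε
  λ³ = trans (∙-congˡ (∙-congˡ (sym (identityʳ lam)))) λ³≈ε
  open Construction P μ lam μ² λ³
  open Subgroups
  open CosetGraph
  open NormalQuotient
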